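{- Let $T$ be a tree and $k\geq 2$ an integer. Let $x$ be a vertex of degree $k+1$ in $T$ adjacent to $k$ leaves $u_1,\dots,u_k$ and to a non-leaf vertex $t$. Suppose $t$ is adjacent to a leaf $y$. Let $T'=T-xt+xy$ be the tree obtained from $T$ by deleting the edge $xt$ and adding the edge $xy$. Then $\Phi(T)\leq\Phi(T')$. Moreover, if $|V(T)\setminus\{u_1,\dots,u_k,x,y\}|\geq 3$, then $\Phi(T)<\Phi(T')$.
   Context: A dissociation set of a graph $G$ is a set $S\subseteq V(G)$ such that every vertex of the induced subgraph $G[S]$ has degree at most $1$; it is maximal if it is not a proper subset of another dissociation set. $\Phi(G)$ is the number of maximal dissociation sets of $G$. A leaf is a vertex of degree $1$. -}

module Defs where

open import Data.Nat using (ℕ; zero; suc; _≤_; _≤?_)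
open import Data.Nat.Properties using ()
open import Data.Bool using (Bool; true; false; if_then_else_; _∧_; _∨_)
open import Data.Fin using (Fin)
open import Data.Fin.Properties using (_≟_; all?; any?)
open import Data.Fin.Subset using (Subset; _∈_; _⊂_; inside; outside)
open import Data.Fin.Subset.Properties using (_∈?_; _⊂?_; anySubset?)
open import Data.List using (List; []; _∷_; length; filter; allFin; _++_; map)
open import Data.List.Relation.Unary.Unique.Propositional using (Unique)
open import Data.Vec using (Vec; []; _∷_)
open import Data.Product using (Σ; ∃; ∃-syntax; _×_; _,_)
open import Relation.Binary.PropositionalEquality using (_≡_; refl)
open import Relation.Nullary using (¬_; Dec; yes; no)
open import Relation.Nullary.Decidable using (_×-dec_; _→-dec_; ¬?; ⌊_⌋)
open import Data.Unit using (⊤)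
open import Data.Empty using (⊥)
open import Data.Bool.Properties using () renaming (_≟_ to _≟ᵇ_)

count : ∀ {a p} {A : Set a} {P : A → Set p} → ((x : A) → Dec (P x)) → List A → ℕ
count P? xs = length (filter P? xs)

Adj : ℕ → Set
Adj n = Fin n → Fin n → Bool

record IsSimpleGraph {n : ℕ} (G : Adj n) : Set where
  field
    symmetric   : ∀ u v → G u v ≡ G v u
    irreflexive : ∀ v → G v v ≡ false

deg : ∀ {n} → Adj n → Fin n → ℕ
deg {n} G v = count (λ w → G v w ≟ᵇ true) (allFin n)

IsLeaf : ∀ {n} → Adj n → Fin n → Set
IsLeaf G v = deg G v ≡ 1

data Walk {n : ℕ} (G : Adj n) : Fin n → Fin n → Set where
  stay : ∀ {u} → Walk G u u
  step : ∀ {u w v} → G u w ≡ true → Walk G w v → Walk G u v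

Connected : ∀ {n} → Adj n → Set
Connected G = ∀ u v → Walk G u v

Chain : ∀ {n} → Adj n → List (Fin n) → Set
Chain G []            = ⊤
Chain G (a ∷ [])      = ⊤
Chain G (a ∷ b ∷ xs)  = (G a b ≡ true) × Chain G (b ∷ xs)

record Cycle {n : ℕ} (G : Adj n) : Set where
  field
    v₀ v₁ : Fin n
    rest  : List (Fin n)
    vₘ    : Fin n
    distinct : Unique (v₀ ∷ v₁ ∷ rest Data.List.++ (vₘ ∷ []))
    chain    : Chain G (v₀ ∷ v₁ ∷ rest Data.List.++ (vₘ ∷ []))
    closing  : G vₘ v₀ ≡ true

Acyclic : ∀ {n} → Adj n → Set
Acyclic G = ¬ Cycle G

record IsTree {n : ℕ} (G : Adj n) : Set where
  field
    simple    : IsSimpleGraph G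
    nonempty  : Fin n
    connected : Connected G
    acyclic   : Acyclic G

degIn : ∀ {n} → Adj n → Subset n → Fin n → ℕ
degIn {n} G S v = count (λ w → (w ∈? S) ×-dec (G v w ≟ᵇ true)) (allFin n)

IsDissociation : ∀ {n} → Adj n → Subset n → Set
IsDissociation G S = ∀ v → v ∈ S → degIn G S v ≤ 1

isDissociation? : ∀ {n} (G : Adj n) (S : Subset n) → Dec (IsDissociation G S)
isDissociation? G S = all? (λ v → (v ∈? S) →-dec (degIn G S v ≤? 1))

IsMaximalDissociation : ∀ {n} → Adj n → Subset n → Set
IsMaximalDissociation G S =
  IsDissociation G S × ¬ (∃[ S' ] (IsDissociation G S' × S ⊂ S'))

isMaximalDissociation? : ∀ {n} (G : Adj n) (S : Subset n) → Dec (IsMaximalDissociation G S)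
isMaximalDissociation? G S =
  isDissociation? G S ×-dec ¬? (anySubset? (λ S' → isDissociation? G S' ×-dec (S ⊂? S')))

allSubsets : ∀ n → List (Subset n)
allSubsets zero    = [] ∷ []
allSubsets (suc n) = map (inside ∷_) (allSubsets n) ++ map (outside ∷_) (allSubsets n)

Φ : ∀ {n} → Adj n → ℕ
Φ {n} G = count (isMaximalDissociation? G) (allSubsets n)

sameEdge : ∀ {n} → Fin n → Fin n → Fin n → Fin n → Bool
sameEdge a b p q = (⌊ a ≟ p ⌋ ∧ ⌊ b ≟ q ⌋) ∨ (⌊ a ≟ q ⌋ ∧ ⌊ b ≟ p ⌋)

replaceEdge : ∀ {n} → Adj n → Fin n → Fin n → Fin n → Adj n
replaceEdge G x t y a b =
  if sameEdge a b x t then false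
  else if sameEdge a b x y then true
  else G a b

countOutside : ∀ {n k} → (Fin k → Fin n) → Fin n → Fin n → ℕ
countOutside {n} u x y =
  count (λ v → ¬? (v ≟ x) ×-dec (¬? (v ≟ y) ×-dec ¬? (any? (λ i → u i ≟ v)))) (allFin n)

{-# OPTIONS --safe #-}
-- Write T′ for the moved tree, and call the vertices other than x, y and the leaves at x the core; the core
-- contains t, and T and T′ have the same edges inside it. A maximal dissociation set S of T is encoded by a
-- maximal dissociation set of T′ that differs from S only at y, t, the leaf u₁ and possibly one core neighbour
-- v of t, the change depending on which of x, t, y lie in S. Maximality in T′ is inherited from T except near
-- t, where it is checked directly, and the memberships of x, t, y in the code determine the case, so the
-- encoding has a left inverse and Φ(T) ≤ Φ(T′). Three vertices outside {u₁, …, u_k, x, y} yield core vertices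
-- q ~ t and r ∉ {t, q} adjacent to t or q; a maximal dissociation set of T′ containing x, y, q, r is not a code.

module Submission where

open import Defs
open import Data.Bool using (Bool; true; false; if_then_else_; _∧_; _∨_)
open import Data.Bool.Properties using (not-¬; ¬-not; ∧-comm; ∨-comm) renaming (_≟_ to _≟ᵇ_)
open import Data.Empty using (⊥; ⊥-elim)
open import Data.Fin using (Fin) renaming (zero to fzero; suc to fsuc)
open import Data.Fin.Properties using (_≟_; any?; all?; ¬∀⟶∃¬; 0≢1+n)
open import Data.Fin.Subset using (Subset; _∈_; _⊆_; _⊂_)
open import Data.Fin.Subset.Properties using (_∈?_)
open import Data.List using (List; []; _∷_; length; filter; allFin; _++_; map)
open import Data.List.Properties using (length-map; length-++; length-tabulate; map-∘; map-id-local)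
open import Data.List.Membership.Propositional using () renaming (_∈_ to _∈ₗ_)
open import Data.List.Membership.Propositional.Properties
  using (∈-allFin; ∈-filter⁺; ∈-filter⁻; ∈-map⁺; ∈-map⁻; ∈-++⁺ˡ; ∈-++⁺ʳ; ∈-∃++)
open import Data.List.Relation.Unary.Any using (here; there)
import Data.List.Relation.Unary.All as All
open All using ([]; _∷_)
open import Data.List.Relation.Unary.AllPairs using ([]; _∷_)
open import Data.List.Relation.Unary.Unique.Propositional using (Unique)
import Data.List.Relation.Unary.Unique.Propositional.Properties as Unique
open import Data.Nat using (ℕ; zero; suc; _≤_; _<_; z≤n; s≤s)
open import Data.Nat.Properties using (≤-trans; ≤-reflexive; +-suc; <-irrefl)
open import Data.Product using (∃; ∃-syntax; ∃₂; _×_; _,_; proj₁; proj₂)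
open import Data.Sum using (_⊎_; inj₁; inj₂)
open import Data.Vec using ([]; _∷_; lookup; tabulate)
open import Data.Vec.Properties using (lookup∘tabulate; tabulate∘lookup; tabulate-cong; []=⇒lookup; lookup⇒[]=)
open import Data.Vec.Functional using (Vector; updateAt)
open import Data.Vec.Functional.Properties
  using (updateAt-updates; updateAt-minimal; updateAt-id-local; updateAt-updateAt; updateAt-commutes)
open import Function using (_∘_; id; const)
open import Function.Definitions using (Injective)
open import Relation.Binary.PropositionalEquality
import Relation.Binary.Reasoning.Setoid as SetoidReasoning
open import Relation.Nullary using (¬_; Dec; yes; no; does)
open import Relation.Nullary.Decidable using (_×-dec_; _→-dec_; ¬?; ⌊_⌋)
open import Relation.Unary using (Decidable)

-- Counting via retractions

module _ {A : Set} where

  private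
    ∈-++-skip : ∀ {a b : A} ys zs → b ∈ₗ ys ++ a ∷ zs → b ≢ a → b ∈ₗ ys ++ zs
    ∈-++-skip []       zs (here b≡a) b≢a = ⊥-elim (b≢a b≡a)
    ∈-++-skip []       zs (there b∈) b≢a = b∈
    ∈-++-skip (c ∷ ys) zs (here b≡c) b≢a = here b≡c
    ∈-++-skip (c ∷ ys) zs (there b∈) b≢a = there (∈-++-skip ys zs b∈ b≢a)

  Unique-⊆⇒length≤ : ∀ {xs ys : List A} → Unique xs → (∀ {z} → z ∈ₗ xs → z ∈ₗ ys) →
                     length xs ≤ length ys
  Unique-⊆⇒length≤ {[]}     _              _     = z≤n
  Unique-⊆⇒length≤ {a ∷ xs} (a∉xs ∷ xs!) xs⊆ys with ∈-∃++ (xs⊆ys (here refl))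
  ... | ys₁ , zs , refl = ≤-trans (s≤s IH) (≤-reflexive (sym length-split))
    where
    IH : length xs ≤ length (ys₁ ++ zs)
    IH = Unique-⊆⇒length≤ xs! λ z∈ → ∈-++-skip ys₁ zs (xs⊆ys (there z∈)) (≢-sym (All.lookup a∉xs z∈))
    length-split : length (ys₁ ++ a ∷ zs) ≡ suc (length (ys₁ ++ zs))
    length-split = trans (length-++ ys₁) (trans (+-suc (length ys₁) (length zs)) (cong suc (sym (length-++ ys₁))))

  length≤1 : ∀ {xs : List A} → Unique xs → (∀ {a b} → a ∈ₗ xs → b ∈ₗ xs → a ≡ b) → length xs ≤ 1
  length≤1 {[]}         _                 _    = z≤n
  length≤1 {a ∷ []}     _                 _    = s≤s z≤n
  length≤1 {a ∷ b ∷ xs} ((a≢b ∷ _) ∷ _) same = ⊥-elim (a≢b (same (here refl) (there (here refl))))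

module _ {n : ℕ} {P : Fin n → Set} (P? : Decidable P) where

  open import Data.List.Membership.DecPropositional (_≟_ {n}) using () renaming (_∈?_ to _∈ₗ?_)

  Unique⇒length≤count : ∀ {zs} → Unique zs → (∀ {z} → z ∈ₗ zs → P z) → length zs ≤ count P? (allFin n)
  Unique⇒length≤count zs! all-P = Unique-⊆⇒length≤ zs! λ {z} z∈ → ∈-filter⁺ P? (∈-allFin z) (all-P z∈)

  count≤1⇒≡ : count P? (allFin n) ≤ 1 → ∀ {a b} → P a → P b → a ≡ b
  count≤1⇒≡ count≤1 {a} {b} pa pb with a ≟ b
  ... | yes a≡b = a≡b
  ... | no  a≢b = ⊥-elim (<-irrefl refl (≤-trans (Unique⇒length≤count ((a≢b ∷ []) ∷ [] ∷ []) both) count≤1))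
    where
    both : ∀ {z} → z ∈ₗ a ∷ b ∷ [] → P z
    both (here refl)         = pa
    both (there (here refl)) = pb

  ≡⇒count≤1 : (∀ {a b} → P a → P b → a ≡ b) → count P? (allFin n) ≤ 1
  ≡⇒count≤1 same = length≤1 (Unique.filter⁺ P? (Unique.allFin⁺ n))
    λ a∈ b∈ → same (proj₂ (∈-filter⁻ P? {xs = allFin n} a∈)) (proj₂ (∈-filter⁻ P? {xs = allFin n} b∈))

  count≤length⇒∈ : ∀ {zs} → count P? (allFin n) ≤ length zs → Unique zs → (∀ {z} → z ∈ₗ zs → P z) →
                   ∀ {w} → P w → w ∈ₗ zs
  count≤length⇒∈ {zs} count≤ zs! all-P {w} pw with w ∈ₗ? zs
  ... | yes w∈ = w∈
  ... | no  w∉ = ⊥-elim (<-irrefl refl (≤-trans (Unique⇒length≤count (All.tabulate w≢ ∷ zs!) all-P′) count≤))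
    where
    w≢ : ∀ {z} → z ∈ₗ zs → w ≢ z
    w≢ z∈ refl = w∉ z∈
    all-P′ : ∀ {z} → z ∈ₗ w ∷ zs → P z
    all-P′ (here refl) = pw
    all-P′ (there z∈)  = all-P z∈

module _ {A B : Set} {P : A → Set} {Q : B → Set} (P? : Decidable P) (Q? : Decidable Q)
         {xs : List A} {ys : List B} (xs! : Unique xs) (ys-complete : ∀ b → b ∈ₗ ys)
         (f : A → B) (g : B → A) (f-maps : ∀ {a} → P a → Q (f a)) (g-retracts : ∀ {a} → P a → g (f a) ≡ a)
         where

  private
    images : List B
    images = map f (filter P? xs)

    P-of : ∀ {a} → a ∈ₗ filter P? xs → P a
    P-of a∈ = proj₂ (∈-filter⁻ P? {xs = xs} a∈)

    images! : Unique images
    images! = Unique.map⁻ {f = g} (subst Unique (sym g∘images) (Unique.filter⁺ P? xs!))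
      where
      g∘images : map g images ≡ filter P? xs
      g∘images = trans (sym (map-∘ (filter P? xs))) (map-id-local (All.tabulate λ a∈ → g-retracts (P-of a∈)))

    images⊆ : ∀ {b} → b ∈ₗ images → b ∈ₗ filter Q? ys
    images⊆ b∈ with ∈-map⁻ f b∈
    ... | a , a∈ , refl = ∈-filter⁺ Q? (ys-complete (f a)) (f-maps (P-of a∈))

    length-images : length images ≡ count P? xs
    length-images = length-map f (filter P? xs)

  count≤-by-retraction : count P? xs ≤ count Q? ys
  count≤-by-retraction = ≤-trans (≤-reflexive (sym length-images)) (Unique-⊆⇒length≤ images! images⊆)

  count<-by-retraction : ∀ {z} → Q z → (∀ {a} → P a → f a ≢ z) → count P? xs < count Q? ys
  count<-by-retraction {z} qz missed =
    ≤-trans (s≤s (≤-reflexive (sym length-images))) (Unique-⊆⇒length≤ (All.tabulate z∉ ∷ images!) z∷images⊆)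
    where
    z∉ : ∀ {b} → b ∈ₗ images → z ≢ b
    z∉ b∈ refl with ∈-map⁻ f b∈
    ... | a , a∈ , fa≡z = missed (P-of a∈) (sym fa≡z)
    z∷images⊆ : ∀ {b} → b ∈ₗ z ∷ images → b ∈ₗ filter Q? ys
    z∷images⊆ (here refl) = ∈-filter⁺ Q? (ys-complete z) qz
    z∷images⊆ (there b∈)  = images⊆ b∈

∈-allSubsets : ∀ {n} (S : Subset n) → S ∈ₗ allSubsets n
∈-allSubsets {zero}  []          = here refl
∈-allSubsets {suc n} (true ∷ S)  = ∈-++⁺ˡ (∈-map⁺ (true ∷_) (∈-allSubsets S))
∈-allSubsets {suc n} (false ∷ S) = ∈-++⁺ʳ (map (true ∷_) (allSubsets n)) (∈-map⁺ (false ∷_) (∈-allSubsets S))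

allSubsets! : ∀ n → Unique (allSubsets n)
allSubsets! zero    = [] ∷ []
allSubsets! (suc n) =
  Unique.++⁺ (Unique.map⁺ ∷-injectiveʳ (allSubsets! n)) (Unique.map⁺ ∷-injectiveʳ (allSubsets! n)) disjoint
  where
  ∷-injectiveʳ : ∀ {b} {S S′ : Subset n} → b ∷ S ≡ b ∷ S′ → S ≡ S′
  ∷-injectiveʳ refl = refl
  disjoint : ∀ {S} → ¬ (S ∈ₗ map (true ∷_) (allSubsets n) × S ∈ₗ map (false ∷_) (allSubsets n))
  disjoint (S∈₁ , S∈₂) with ∈-map⁻ (true ∷_) S∈₁ | ∈-map⁻ (false ∷_) S∈₂
  ... | _ , _ , refl | _ , _ , ()

updateAt-congˡ : ∀ {A : Set} {n} {xs ys : Vector A n} i (f : A → A) → xs ≗ ys → updateAt xs i f ≗ updateAt ys i f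
updateAt-congˡ {xs = xs} {ys} i f xs≗ys j with j ≟ i
... | yes refl = trans (updateAt-updates j xs) (trans (cong f (xs≗ys j)) (sym (updateAt-updates j ys)))
... | no  j≢i  = trans (updateAt-minimal j i xs j≢i) (trans (xs≗ys j) (sym (updateAt-minimal j i ys j≢i)))

-- Vertex sets as characteristic functions, compared pointwise; Subset n is only needed for counting.
Subsetᶠ : ℕ → Set
Subsetᶠ n = Vector Bool n

module _ {n : ℕ} where

  infixl 6 _⊕_ _⊖_
  infix 4 _⊆ᶠ_

  _⊕_ _⊖_ : Subsetᶠ n → Fin n → Subsetᶠ n
  s ⊕ w = updateAt s w (const true)
  s ⊖ w = updateAt s w (const false)

  _⊆ᶠ_ : Subsetᶠ n → Subsetᶠ n → Set
  s ⊆ᶠ s′ = ∀ z → s z ≡ true → s′ z ≡ true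

  ∈∉⇒≢ : ∀ {s : Subsetᶠ n} {z w} → s z ≡ true → s w ≡ false → z ≢ w
  ∈∉⇒≢ sz sw refl = not-¬ sz sw

  ⊕-self : ∀ s w → (s ⊕ w) w ≡ true
  ⊕-self s w = updateAt-updates w s

  ⊖-self : ∀ s w → (s ⊖ w) w ≡ false
  ⊖-self s w = updateAt-updates w s

  ⊕-other : ∀ s {w z} → z ≢ w → (s ⊕ w) z ≡ s z
  ⊕-other s {w} {z} = updateAt-minimal z w s

  ⊖-other : ∀ s {w z} → z ≢ w → (s ⊖ w) z ≡ s z
  ⊖-other s {w} {z} = updateAt-minimal z w s

  ⊆-⊕ : ∀ s w → s ⊆ᶠ s ⊕ w
  ⊆-⊕ s w z sz with z ≟ w
  ... | yes refl = ⊕-self s z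
  ... | no  z≢w  = trans (⊕-other s z≢w) sz

  ⊕-∈⁻ : ∀ s w {z} → (s ⊕ w) z ≡ true → z ≢ w → s z ≡ true
  ⊕-∈⁻ s w z∈ z≢w = trans (sym (⊕-other s z≢w)) z∈

  ⊕-cases : ∀ s w {z} → (s ⊕ w) z ≡ true → z ≡ w ⊎ s z ≡ true
  ⊕-cases s w {z} z∈ with z ≟ w
  ... | yes z≡w = inj₁ z≡w
  ... | no  z≢w = inj₂ (⊕-∈⁻ s w z∈ z≢w)

  ⊕-mono : ∀ {s s′} w → s ⊆ᶠ s′ → s ⊕ w ⊆ᶠ s′ ⊕ w
  ⊕-mono {s} {s′} w s⊆s′ z z∈ with ⊕-cases s w z∈
  ... | inj₁ refl = ⊕-self s′ z
  ... | inj₂ sz   = ⊆-⊕ s′ w z (s⊆s′ z sz)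

  ⊖-⊆ : ∀ s w → s ⊖ w ⊆ᶠ s
  ⊖-⊆ s w z z∈ with z ≟ w
  ... | yes refl = ⊥-elim (not-¬ z∈ (⊖-self s z))
  ... | no  z≢w  = trans (sym (⊖-other s z≢w)) z∈

  ⊕-cong : ∀ {s s′} w → s ≗ s′ → s ⊕ w ≗ s′ ⊕ w
  ⊕-cong w = updateAt-congˡ w (const true)

  ⊖-cong : ∀ {s s′} w → s ≗ s′ → s ⊖ w ≗ s′ ⊖ w
  ⊖-cong w = updateAt-congˡ w (const false)

  ⊖⊕-cancel : ∀ {s w} → s w ≡ true → s ⊖ w ⊕ w ≗ s
  ⊖⊕-cancel {s} {w} sw z = trans (updateAt-updateAt w s z) (updateAt-id-local w s (sym sw) z)

  ⊕⊖-cancel : ∀ {s w} → s w ≡ false → s ⊕ w ⊖ w ≗ s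
  ⊕⊖-cancel {s} {w} sw z = trans (updateAt-updateAt w s z) (updateAt-id-local w s (sym sw) z)

  ≗⇒⊆ᶠ : ∀ {s s′} → s ≗ s′ → s ⊆ᶠ s′
  ≗⇒⊆ᶠ s≗s′ z sz = trans (sym (s≗s′ z)) sz

  ⊕-comm : ∀ s a b → s ⊕ a ⊕ b ≗ s ⊕ b ⊕ a
  ⊕-comm s a b with a ≟ b
  ... | yes refl = λ _ → refl
  ... | no a≢b   = updateAt-commutes b a (≢-sym a≢b) s

  ⊕⊖-comm : ∀ s {a b} → b ≢ a → s ⊕ a ⊖ b ≗ s ⊖ b ⊕ a
  ⊕⊖-comm s {a} {b} b≢a = updateAt-commutes b a b≢a s

  module _ {P : Fin n → Set} where

    infixl 6 _∖_

    _∖_ : Subsetᶠ n → Decidable P → Subsetᶠ n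
    (s ∖ P?) z = if does (P? z) then false else s z

    ∖-excludes : ∀ s (P? : Decidable P) {z} → P z → (s ∖ P?) z ≡ false
    ∖-excludes s P? {z} pz with P? z
    ... | yes _  = refl
    ... | no ¬pz = ⊥-elim (¬pz pz)

    ∖-keeps : ∀ s (P? : Decidable P) {z} → ¬ P z → (s ∖ P?) z ≡ s z
    ∖-keeps s P? {z} ¬pz with P? z
    ... | yes pz = ⊥-elim (¬pz pz)
    ... | no _   = refl

    ∖-⊆ : ∀ s (P? : Decidable P) → s ∖ P? ⊆ᶠ s
    ∖-⊆ s P? z z∈ with P? z
    ... | no _ = z∈

    ∖-at : ∀ s s′ (P? : Decidable P) {z} → s z ≡ s′ z → (s ∖ P?) z ≡ (s′ ∖ P?) z
    ∖-at s s′ P? {z} eq with P? z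
    ... | yes _ = refl
    ... | no _  = eq

    ∖-cong : ∀ {s s′} (P? : Decidable P) → s ≗ s′ → s ∖ P? ≗ s′ ∖ P?
    ∖-cong {s} {s′} P? s≗s′ z = ∖-at s s′ P? (s≗s′ z)

    ∖-avoids : ∀ {s} (P? : Decidable P) → (∀ z → P z → s z ≡ false) → s ∖ P? ≗ s
    ∖-avoids P? avoids z with P? z
    ... | yes pz = sym (avoids z pz)
    ... | no _   = refl

    ∖-⊕-inside : ∀ s (P? : Decidable P) {w} → P w → s ⊕ w ∖ P? ≗ s ∖ P?
    ∖-⊕-inside s P? {w} pw z with P? z
    ... | yes _  = refl
    ... | no ¬pz = ⊕-other s λ { refl → ¬pz pw }

    ∖-⊕-outside : ∀ s (P? : Decidable P) {w} → ¬ P w → s ⊕ w ∖ P? ≗ (s ∖ P?) ⊕ w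
    ∖-⊕-outside s P? {w} ¬pw z with z ≟ w
    ... | yes refl = trans (∖-keeps (s ⊕ z) P? ¬pw) (trans (⊕-self s z) (sym (⊕-self (s ∖ P?) z)))
    ... | no z≢w   = trans (∖-at (s ⊕ w) s P? (⊕-other s z≢w)) (sym (⊕-other (s ∖ P?) z≢w))

    ∖-⊖ : ∀ s (P? : Decidable P) w → s ⊖ w ∖ P? ≗ (s ∖ P?) ⊖ w
    ∖-⊖ s P? w z with z ≟ w
    ... | yes refl =
      trans (¬-not λ z∈ → not-¬ (∖-⊆ (s ⊖ z) P? z z∈) (⊖-self s z)) (sym (⊖-self (s ∖ P?) z))
    ... | no z≢w = trans (∖-at (s ⊖ w) s P? (⊖-other s z≢w)) (sym (⊖-other (s ∖ P?) z≢w))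

  ⊖⊕⊖⊕-cancel : ∀ {s a b} → s a ≡ true → s b ≡ false → a ≢ b → s ⊖ a ⊕ b ⊖ b ⊕ a ≗ s
  ⊖⊕⊖⊕-cancel {s} {a} {b} sa sb a≢b z =
    trans (⊕-cong a (⊕⊖-cancel (trans (⊖-other s (≢-sym a≢b)) sb)) z) (⊖⊕-cancel sa z)

data Conflict {n : ℕ} (G : Adj n) (s : Subsetᶠ n) : Set where
  conflict : ∀ v a b → s v ≡ true → s a ≡ true → s b ≡ true → G v a ≡ true → G v b ≡ true → a ≢ b →
             Conflict G s

module _ {n : ℕ} (G : Adj n) where

  Dissociated : Subsetᶠ n → Set
  Dissociated s = ¬ Conflict G s

  MaximalDissociated : Subsetᶠ n → Set
  MaximalDissociated s = Dissociated s × (∀ w → s w ≡ false → Conflict G (s ⊕ w))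

  conflict-mono : ∀ {s s′} → s ⊆ᶠ s′ → Conflict G s → Conflict G s′
  conflict-mono s⊆s′ (conflict v a b sv sa sb va vb a≢b) =
    conflict v a b (s⊆s′ v sv) (s⊆s′ a sa) (s⊆s′ b sb) va vb a≢b

  conflict? : ∀ s → Dec (Conflict G s)
  conflict? s with any? (λ v → any? (λ a → any? (λ b →
      (s v ≟ᵇ true) ×-dec (s a ≟ᵇ true) ×-dec (s b ≟ᵇ true) ×-dec
      (G v a ≟ᵇ true) ×-dec (G v b ≟ᵇ true) ×-dec ¬? (a ≟ b))))
  ... | yes (v , a , b , sv , sa , sb , va , vb , a≢b) = yes (conflict v a b sv sa sb va vb a≢b)
  ... | no none = no λ { (conflict v a b sv sa sb va vb a≢b) → none (v , a , b , sv , sa , sb , va , vb , a≢b) }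

  maximal? : ∀ s → Dec (MaximalDissociated s)
  maximal? s = ¬? (conflict? s) ×-dec all? λ w → (s w ≟ᵇ false) →-dec conflict? (s ⊕ w)

  maximal-resp-≗ : ∀ {s s′} → s ≗ s′ → MaximalDissociated s → MaximalDissociated s′
  maximal-resp-≗ s≗s′ (dissociated , blocked) =
      (λ c → dissociated (conflict-mono (λ z → trans (s≗s′ z)) c))
    , λ w s′w → conflict-mono (λ z → trans (sym (⊕-cong w s≗s′ z))) (blocked w (trans (s≗s′ w) s′w))

  ¬maximal⇒extensible : ∀ {s} → Dissociated s → ¬ MaximalDissociated s →
                        ∃ λ w → s w ≡ false × Dissociated (s ⊕ w)
  ¬maximal⇒extensible {s} dissociated ¬maximal
    with ¬∀⟶∃¬ n _ (λ w → (s w ≟ᵇ false) →-dec conflict? (s ⊕ w))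
               (λ blocked → ¬maximal (dissociated , blocked))
  ... | w , ¬blocked with s w ≟ᵇ false
  ...   | yes sw = w , sw , λ c → ¬blocked λ _ → c
  ...   | no sw≢ = ⊥-elim (¬blocked λ sw → ⊥-elim (sw≢ sw))

  data ConflictThrough (s : Subsetᶠ n) (w : Fin n) : Set where
    centre : ∀ a b → s a ≡ true → s b ≡ true → G w a ≡ true → G w b ≡ true → a ≢ b → ConflictThrough s w
    end    : ∀ v b → s v ≡ true → s b ≡ true → G v w ≡ true → G v b ≡ true → b ≢ w → ConflictThrough s w

  conflict-through-new : (∀ v → G v v ≡ false) → ∀ {s w} → Dissociated s → Conflict G (s ⊕ w) →
                         ConflictThrough s w
  conflict-through-new irreflexive {s} {w} dissociated (conflict v a b sv sa sb va vb a≢b)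
    with v ≟ w | a ≟ w | b ≟ w
  ... | yes refl | _ | _ = centre a b (⊕-∈⁻ s w sa (loopless va)) (⊕-∈⁻ s w sb (loopless vb)) va vb a≢b
    where
    loopless : ∀ {z} → G w z ≡ true → z ≢ w
    loopless wz refl = not-¬ wz (irreflexive w)
  ... | no v≢w | yes refl | _        =
    end v b (⊕-∈⁻ s w sv v≢w) (⊕-∈⁻ s w sb (≢-sym a≢b)) va vb (≢-sym a≢b)
  ... | no v≢w | no _     | yes refl =
    end v a (⊕-∈⁻ s w sv v≢w) (⊕-∈⁻ s w sa a≢b) vb va a≢b
  ... | no v≢w | no a≢w   | no b≢w   =
    ⊥-elim (dissociated (conflict v a b (⊕-∈⁻ s w sv v≢w) (⊕-∈⁻ s w sa a≢w) (⊕-∈⁻ s w sb b≢w)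
                                        va vb a≢b))

  private
    extend : Subsetᶠ n → List (Fin n) → Subsetᶠ n
    extend s []       = s
    extend s (v ∷ vs) with conflict? (s ⊕ v)
    ... | yes _ = extend s vs
    ... | no _  = extend (s ⊕ v) vs

    ⊆-extend : ∀ s vs → s ⊆ᶠ extend s vs
    ⊆-extend s []       z sz = sz
    ⊆-extend s (v ∷ vs) z sz with conflict? (s ⊕ v)
    ... | yes _ = ⊆-extend s vs z sz
    ... | no _  = ⊆-extend (s ⊕ v) vs z (⊆-⊕ s v z sz)

    extend-dissociated : ∀ s vs → Dissociated s → Dissociated (extend s vs)
    extend-dissociated s []       d = d
    extend-dissociated s (v ∷ vs) d with conflict? (s ⊕ v)
    ... | yes _ = extend-dissociated s vs d
    ... | no d′ = extend-dissociated (s ⊕ v) vs d′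

    extend-blocks : ∀ s vs {w} → w ∈ₗ vs → extend s vs w ≡ false → Conflict G (extend s vs ⊕ w)
    extend-blocks s (v ∷ vs) (here refl) out with conflict? (s ⊕ v)
    ... | yes c = conflict-mono (⊕-mono v (⊆-extend s vs)) c
    ... | no _  = ⊥-elim (not-¬ (⊆-extend (s ⊕ v) vs v (⊕-self s v)) out)
    extend-blocks s (v ∷ vs) (there w∈) out with conflict? (s ⊕ v)
    ... | yes _ = extend-blocks s vs w∈ out
    ... | no _  = extend-blocks (s ⊕ v) vs w∈ out

  dissociated⇒⊆maximal : ∀ {s} → Dissociated s → ∃[ m ] s ⊆ᶠ m × MaximalDissociated m
  dissociated⇒⊆maximal {s} d =
    extend s (allFin n) , ⊆-extend s (allFin n) ,
    extend-dissociated s (allFin n) d , λ w → extend-blocks s (allFin n) (∈-allFin w)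

module _ {n : ℕ} (G : Adj n) where

  private
    ∈⇒true : ∀ {z} {S : Subset n} → z ∈ S → lookup S z ≡ true
    ∈⇒true = []=⇒lookup

    true⇒∈ : ∀ {z} {S : Subset n} → lookup S z ≡ true → z ∈ S
    true⇒∈ {z} {S} = lookup⇒[]= z S

  isDissociation⇒dissociated : ∀ S → IsDissociation G S → Dissociated G (lookup S)
  isDissociation⇒dissociated S isDiss (conflict v a b sv sa sb va vb a≢b) =
    a≢b (count≤1⇒≡ (λ w → (w ∈? S) ×-dec (G v w ≟ᵇ true)) (isDiss v (true⇒∈ sv))
                   (true⇒∈ sa , va) (true⇒∈ sb , vb))

  dissociated⇒isDissociation : ∀ S → Dissociated G (lookup S) → IsDissociation G S
  dissociated⇒isDissociation S d v v∈S = ≡⇒count≤1 (λ w → (w ∈? S) ×-dec (G v w ≟ᵇ true)) same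
    where
    same : ∀ {a b} → a ∈ S × G v a ≡ true → b ∈ S × G v b ≡ true → a ≡ b
    same {a} {b} (a∈S , va) (b∈S , vb) with a ≟ b
    ... | yes a≡b = a≡b
    ... | no a≢b  = ⊥-elim (d (conflict v a b (∈⇒true v∈S) (∈⇒true a∈S) (∈⇒true b∈S) va vb a≢b))

  isMaximal⇒maximal : ∀ S → IsMaximalDissociation G S → MaximalDissociated G (lookup S)
  isMaximal⇒maximal S (isDiss , unextendable) = isDissociation⇒dissociated S isDiss , blocked
    where
    blocked : ∀ w → lookup S w ≡ false → Conflict G (lookup S ⊕ w)
    blocked w w∉ with conflict? G (lookup S ⊕ w)
    ... | yes c = c
    ... | no d  = ⊥-elim (unextendable (S′ , dissociated⇒isDissociation S′ d′ , S⊆S′ , w , w∈S′ , w∉S))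
      where
      S′ : Subset n
      S′ = tabulate (lookup S ⊕ w)
      d′ : Dissociated G (lookup S′)
      d′ c = d (conflict-mono G (λ z → trans (sym (lookup∘tabulate (lookup S ⊕ w) z))) c)
      S⊆S′ : S ⊆ S′
      S⊆S′ {z} z∈S = true⇒∈ (trans (lookup∘tabulate _ z) (⊆-⊕ (lookup S) w z (∈⇒true z∈S)))
      w∈S′ : w ∈ S′
      w∈S′ = true⇒∈ (trans (lookup∘tabulate _ w) (⊕-self (lookup S) w))
      w∉S : ¬ (w ∈ S)
      w∉S w∈S = not-¬ (∈⇒true w∈S) w∉

  maximal⇒isMaximal : ∀ S → MaximalDissociated G (lookup S) → IsMaximalDissociation G S
  maximal⇒isMaximal S (d , blocked) = dissociated⇒isDissociation S d , unextendable
    where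
    unextendable : ¬ (∃[ S′ ] (IsDissociation G S′ × S ⊂ S′))
    unextendable (S′ , isDiss′ , S⊆S′ , w , w∈S′ , w∉S) =
      isDissociation⇒dissociated S′ isDiss′
        (conflict-mono G S⊕w⊆S′ (blocked w (¬-not (λ w∈ → w∉S (true⇒∈ w∈)))))
      where
      S⊕w⊆S′ : lookup S ⊕ w ⊆ᶠ lookup S′
      S⊕w⊆S′ z z∈ with ⊕-cases (lookup S) w z∈
      ... | inj₁ refl = ∈⇒true w∈S′
      ... | inj₂ z∈S  = ∈⇒true (S⊆S′ (true⇒∈ z∈S))

conflict-transfer : ∀ {n} {G G′ : Adj n} {x s} → (∀ {a b} → a ≢ x → b ≢ x → G a b ≡ G′ a b) →
                    s x ≡ false → Conflict G s → Conflict G′ s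
conflict-transfer G≡G′ sx (conflict v a b sv sa sb v~a v~b a≢b) =
  conflict v a b sv sa sb (trans (sym (G≡G′ (∈∉⇒≢ sv sx) (∈∉⇒≢ sa sx))) v~a)
                          (trans (sym (G≡G′ (∈∉⇒≢ sv sx) (∈∉⇒≢ sb sx))) v~b) a≢b

walk-exits : ∀ {n} {G : Adj n} {P : Fin n → Set} → Decidable P → ∀ {a b} → Walk G a b → P a → ¬ P b →
             ∃₂ λ p q → P p × ¬ P q × G p q ≡ true
walk-exits P? stay                     pa ¬pb = ⊥-elim (¬pb pa)
walk-exits P? (step {w = w} a~w w⇝b) pa ¬pb with P? w
... | yes pw = walk-exits P? w⇝b pw ¬pb
... | no ¬pw = _ , w , pa , ¬pw , a~w

module SimpleGraph {n : ℕ} {G : Adj n} (simple : IsSimpleGraph G) where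

  open IsSimpleGraph simple public

  adj-sym : ∀ {a b} → G a b ≡ true → G b a ≡ true
  adj-sym {a} {b} = trans (symmetric b a)

  adj⇒≢ : ∀ {a b} → G a b ≡ true → a ≢ b
  adj⇒≢ {a} a~b refl = not-¬ a~b (irreflexive a)

  pendant-addable : ∀ {p c s} → (∀ {z} → G p z ≡ true → z ≡ c) → Dissociated G s → s c ≡ false →
                    Dissociated G (s ⊕ p)
  pendant-addable only-c d sc c with conflict-through-new G irreflexive d c
  ... | centre _ _ _ _ p~a p~b a≢b = a≢b (trans (only-c p~a) (sym (only-c p~b)))
  ... | end _ _ sv _ v~p _ _       = not-¬ (subst (λ z → _ ≡ true) (only-c (adj-sym v~p)) sv) sc

  pendant-∈ : ∀ {p c s} → (∀ {z} → G p z ≡ true → z ≡ c) → MaximalDissociated G s → s c ≡ false →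
              s p ≡ true
  pendant-∈ only-c (d , blocked) sc = ¬-not λ sp → pendant-addable only-c d sc (blocked _ sp)

sameEdge-sym : ∀ {n} (a b p q : Fin n) → sameEdge a b p q ≡ sameEdge b a p q
sameEdge-sym a b p q =
  trans (∨-comm (⌊ a ≟ p ⌋ ∧ ⌊ b ≟ q ⌋) _)
        (cong₂ _∨_ (∧-comm ⌊ a ≟ q ⌋ ⌊ b ≟ p ⌋) (∧-comm ⌊ a ≟ p ⌋ ⌊ b ≟ q ⌋))

replaceEdge-sym : ∀ {n} {G : Adj n} → (∀ a b → G a b ≡ G b a) → ∀ p q r a b →
                  replaceEdge G p q r a b ≡ replaceEdge G p q r b a
replaceEdge-sym sym-G p q r a b rewrite sameEdge-sym a b p q | sameEdge-sym a b p r | sym-G a b = refl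

module StarMove {n : ℕ} (T : Adj n) (simple : IsSimpleGraph T) (x t y u₀ u₁ : Fin n)
  (x~t : T x t ≡ true) (t~y : T t y ≡ true)
  (x~u₀ : T x u₀ ≡ true) (x~u₁ : T x u₁ ≡ true) (u₀≢u₁ : u₀ ≢ u₁)
  (u₀≢t : u₀ ≢ t) (u₁≢t : u₁ ≢ t)
  (x-pendants : ∀ {w} → T x w ≡ true → w ≢ t → ∀ {z} → T w z ≡ true → z ≡ x)
  (y-pendant : ∀ {z} → T y z ≡ true → z ≡ t)
  where

  open SimpleGraph simple
  module ≗-Reasoning = SetoidReasoning (Fin n →-setoid Bool)

  x≢t : x ≢ t
  x≢t = adj⇒≢ x~t

  t≢y : t ≢ y
  t≢y = adj⇒≢ t~y

  x≢y : x ≢ y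
  x≢y refl = u₀≢t (y-pendant x~u₀)

  Leaf : Fin n → Set
  Leaf z = T x z ≡ true × z ≢ t

  leaf? : Decidable Leaf
  leaf? z = (T x z ≟ᵇ true) ×-dec ¬? (z ≟ t)

  leaf-nbr : ∀ {z w} → Leaf z → T z w ≡ true → w ≡ x
  leaf-nbr (x~z , z≢t) = x-pendants x~z z≢t

  leaf≢x : ∀ {z} → Leaf z → z ≢ x
  leaf≢x (x~z , _) = ≢-sym (adj⇒≢ x~z)

  leaf≢y : ∀ {z} → Leaf z → z ≢ y
  leaf≢y (x~z , _) refl = x≢t (y-pendant (adj-sym x~z))

  u₀-leaf : Leaf u₀
  u₀-leaf = x~u₀ , u₀≢t

  u₁-leaf : Leaf u₁
  u₁-leaf = x~u₁ , u₁≢t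

  Core : Fin n → Set
  Core z = z ≢ x × z ≢ y × (T x z ≡ true → z ≡ t)

  core? : Decidable Core
  core? z = ¬? (z ≟ x) ×-dec ¬? (z ≟ y) ×-dec ((T x z ≟ᵇ true) →-dec (z ≟ t))

  t-core : Core t
  t-core = ≢-sym x≢t , t≢y , λ _ → refl

  core≢x : ∀ {z} → Core z → z ≢ x
  core≢x = proj₁

  core≢y : ∀ {z} → Core z → z ≢ y
  core≢y = proj₁ ∘ proj₂

  core⇒¬leaf : ∀ {z} → Core z → ¬ Leaf z
  core⇒¬leaf (_ , _ , only-t) (x~z , z≢t) = z≢t (only-t x~z)

  data Class (z : Fin n) : Set where
    is-x    : z ≡ x → Class z
    is-y    : z ≡ y → Class z
    is-leaf : Leaf z → Class z
    is-core : Core z → Class z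

  classify : ∀ z → Class z
  classify z with z ≟ x | z ≟ y | leaf? z
  ... | yes z≡x | _       | _      = is-x z≡x
  ... | no _    | yes z≡y | _      = is-y z≡y
  ... | no _    | no _    | yes lz = is-leaf lz
  ... | no z≢x  | no z≢y  | no ¬lz = is-core (z≢x , z≢y , only-t)
    where
    only-t : T x z ≡ true → z ≡ t
    only-t x~z with z ≟ t
    ... | yes z≡t = z≡t
    ... | no z≢t  = ⊥-elim (¬lz (x~z , z≢t))

  core-nbr : ∀ {v a} → Core v → T v a ≡ true → Core a ⊎ (v ≡ t × (a ≡ x ⊎ a ≡ y))
  core-nbr {v} {a} cv v~a with classify a
  ... | is-x refl  = inj₂ (proj₂ (proj₂ cv) (adj-sym v~a) , inj₁ refl)
  ... | is-y refl  = inj₂ (y-pendant (adj-sym v~a) , inj₂ refl)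
  ... | is-leaf la = ⊥-elim (core≢x cv (leaf-nbr la (adj-sym v~a)))
  ... | is-core ca = inj₁ ca

  core-nbr-off-t : ∀ {v a} → Core v → v ≢ t → T v a ≡ true → Core a
  core-nbr-off-t cv v≢t v~a with core-nbr cv v~a
  ... | inj₁ ca       = ca
  ... | inj₂ (v≡t , _) = ⊥-elim (v≢t v≡t)

  Nt : Fin n → Set
  Nt z = Core z × T t z ≡ true

  nt? : Decidable Nt
  nt? z = core? z ×-dec (T t z ≟ᵇ true)

  ¬Nt-t : ¬ Nt t
  ¬Nt-t (_ , t~t) = adj⇒≢ t~t refl

  ¬Nt-y : ¬ Nt y
  ¬Nt-y (cy , _) = core≢y cy refl

  ¬Nt-leaf : ∀ {z} → Leaf z → ¬ Nt z
  ¬Nt-leaf lz (cz , _) = core⇒¬leaf cz lz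

  T′ : Adj n
  T′ = replaceEdge T x t y

  T′-sym : ∀ {a b} → T′ a b ≡ true → T′ b a ≡ true
  T′-sym {a} {b} = trans (replaceEdge-sym symmetric x t y b a)

  T′≡T : ∀ {a b} → a ≢ x → b ≢ x → T′ a b ≡ T a b
  T′≡T {a} {b} a≢x b≢x with a ≟ x | b ≟ x
  ... | yes a≡x | _       = ⊥-elim (a≢x a≡x)
  ... | no _    | yes b≡x = ⊥-elim (b≢x b≡x)
  ... | no _    | no _ with a ≟ t | a ≟ y
  ... | yes _ | yes _ = refl
  ... | yes _ | no _  = refl
  ... | no _  | yes _ = refl
  ... | no _  | no _  = refl

  T′-from-x : ∀ b → T′ x b ≡ (if ⌊ b ≟ t ⌋ then false else if ⌊ b ≟ y ⌋ then true else T x b)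
  T′-from-x b with x ≟ x | x ≟ t | x ≟ y
  ... | no x≢x | _       | _       = ⊥-elim (x≢x refl)
  ... | yes _  | yes x≡t | _       = ⊥-elim (x≢t x≡t)
  ... | yes _  | no _    | yes x≡y = ⊥-elim (x≢y x≡y)
  ... | yes _  | no _    | no _ with b ≟ t | b ≟ y
  ... | yes _ | _     = refl
  ... | no _  | yes _ = refl
  ... | no _  | no _  = refl

  T′-x-nbr : ∀ {b} → T′ x b ≡ true → b ≡ y ⊎ Leaf b
  T′-x-nbr {b} x~b with b ≟ t | b ≟ y | trans (sym (T′-from-x b)) x~b
  ... | yes _  | _       | ()
  ... | no _   | yes b≡y | _   = inj₁ b≡y
  ... | no b≢t | no _    | x~b′ = inj₂ (x~b′ , b≢t)

  T′-x-y : T′ x y ≡ true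
  T′-x-y with y ≟ t | y ≟ y | T′-from-x y
  ... | yes y≡t | _      | _ = ⊥-elim (t≢y (sym y≡t))
  ... | no _    | no y≢y | _ = ⊥-elim (y≢y refl)
  ... | no _    | yes _  | e = e

  T′-x-leaf : ∀ {b} → Leaf b → T′ x b ≡ true
  T′-x-leaf {b} lb@(x~b , b≢t) with b ≟ t | b ≟ y | T′-from-x b
  ... | yes b≡t | _       | _ = ⊥-elim (b≢t b≡t)
  ... | no _    | yes b≡y | _ = ⊥-elim (leaf≢y lb b≡y)
  ... | no _    | no _    | e = trans e x~b

  T′-y-t : T′ y t ≡ true
  T′-y-t = trans (T′≡T (≢-sym x≢y) (≢-sym x≢t)) (adj-sym t~y)

  T′-y-nbr : ∀ {b} → T′ y b ≡ true → b ≢ x → b ≡ t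
  T′-y-nbr y~b b≢x = y-pendant (trans (sym (T′≡T (≢-sym x≢y) b≢x)) y~b)

  T′-core : ∀ {a b} → Core a → Core b → T′ a b ≡ T a b
  T′-core ca cb = T′≡T (core≢x ca) (core≢x cb)

  data T′-Conflict (s : Subsetᶠ n) : Set where
    off-x : Conflict T (s ⊖ x) → T′-Conflict s
    at-x  : ∀ a b → a ≢ b → s a ≡ true → s b ≡ true → (a ≡ y ⊎ Leaf a) → (b ≡ y ⊎ Leaf b) →
            T′-Conflict s
    at-y  : s y ≡ true → s t ≡ true → T′-Conflict s

  private
    ends-at-x : ∀ {s v b} → v ≢ x → b ≢ x → s v ≡ true → s b ≡ true →
                T′ v x ≡ true → T′ v b ≡ true → T′-Conflict s
    ends-at-x {s} {v} v≢x b≢x sv sb v~x v~b with T′-x-nbr {v} (T′-sym {v} v~x)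
    ... | inj₁ refl = at-y sv (subst (λ z → s z ≡ true) (T′-y-nbr v~b b≢x) sb)
    ... | inj₂ lv   = ⊥-elim (b≢x (leaf-nbr lv (trans (sym (T′≡T v≢x b≢x)) v~b)))

  classify-T′-conflict : ∀ {s} → Conflict T′ s → T′-Conflict s
  classify-T′-conflict {s} (conflict v a b sv sa sb v~a v~b a≢b) = go (v ≟ x) (a ≟ x) (b ≟ x)
    where
    go : Dec (v ≡ x) → Dec (a ≡ x) → Dec (b ≡ x) → T′-Conflict s
    go (yes v≡x) _         _         = at-x a b a≢b sa sb (T′-x-nbr {a} (subst (λ z → T′ z a ≡ true) v≡x v~a))
                                                           (T′-x-nbr {b} (subst (λ z → T′ z b ≡ true) v≡x v~b))
    go (no v≢x)  (yes a≡x) _         =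
      ends-at-x v≢x (λ b≡x → a≢b (trans a≡x (sym b≡x))) sv sb (subst (λ z → T′ v z ≡ true) a≡x v~a) v~b
    go (no v≢x)  (no _)    (yes b≡x) =
      ends-at-x v≢x (λ a≡x → a≢b (trans a≡x (sym b≡x))) sv sa (subst (λ z → T′ v z ≡ true) b≡x v~b) v~a
    go (no v≢x)  (no a≢x)  (no b≢x)  =
      off-x (conflict v a b (trans (⊖-other s v≢x) sv) (trans (⊖-other s a≢x) sa) (trans (⊖-other s b≢x) sb)
                            (trans (sym (T′≡T v≢x a≢x)) v~a) (trans (sym (T′≡T v≢x b≢x)) v~b) a≢b)

  data CoreConflict (s : Subsetᶠ n) : Set where
    core-conflict : ∀ v a b → Core v → Core a → Core b → s v ≡ true → s a ≡ true → s b ≡ true →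
                    T v a ≡ true → T v b ≡ true → a ≢ b → CoreConflict s

  infix 4 _⊆ᶜ_
  _⊆ᶜ_ : Subsetᶠ n → Subsetᶠ n → Set
  s ⊆ᶜ s′ = ∀ z → Core z → s z ≡ true → s′ z ≡ true

  core-conflict⇒T′ : ∀ {s s′} → s ⊆ᶜ s′ → CoreConflict s → Conflict T′ s′
  core-conflict⇒T′ s⊆s′ (core-conflict v a b cv ca cb sv sa sb v~a v~b a≢b) =
    conflict v a b (s⊆s′ v cv sv) (s⊆s′ a ca sa) (s⊆s′ b cb sb)
                   (trans (T′-core cv ca) v~a) (trans (T′-core cv cb) v~b) a≢b

  new-core-conflict : ∀ {s w} → Dissociated T s → Core w → w ≢ t → Conflict T (s ⊕ w) →
                      CoreConflict (s ⊕ w) ⊎ (T t w ≡ true × s t ≡ true)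
  new-core-conflict {s} {w} d cw w≢t c with conflict-through-new T irreflexive d c
  ... | centre a b sa sb w~a w~b a≢b =
    inj₁ (core-conflict w a b cw (core-nbr-off-t cw w≢t w~a) (core-nbr-off-t cw w≢t w~b)
                        (⊕-self s w) (⊆-⊕ s w a sa) (⊆-⊕ s w b sb) w~a w~b a≢b)
  ... | end v b sv sb v~w v~b b≢w with core-nbr-off-t cw w≢t (adj-sym v~w)
  ...   | cv with core-nbr cv v~b
  ...     | inj₁ cb       =
    inj₁ (core-conflict v w b cv cw cb (⊆-⊕ s w v sv) (⊕-self s w) (⊆-⊕ s w b sb) v~w v~b (≢-sym b≢w))
  ...     | inj₂ (refl , _) = inj₂ (v~w , sv)

  -- Adding y or a leaf to s′ overloads x; adding a core vertex w ≠ t conflicts in T′ as it does in T, unless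
  -- the conflict in T ran through t (possible only when w ~ t and t ∈ s), which is left to the caller.
  blocked-in-T′ : ∀ {s s′ a w} → MaximalDissociated T s → s ⊆ᶜ s′ →
                  s′ x ≡ true → s′ a ≡ true → T′ x a ≡ true → s′ w ≡ false → w ≢ t →
                  (Nt w → s t ≡ true → Conflict T′ (s′ ⊕ w)) → Conflict T′ (s′ ⊕ w)
  blocked-in-T′ {s} {s′} {a} {w} (d , blocked) s⊆s′ s′x s′a x~a s′w w≢t near-t with classify w
  ... | is-x refl  = ⊥-elim (not-¬ s′x s′w)
  ... | is-y refl  = conflict x a w (⊆-⊕ s′ w x s′x) (⊆-⊕ s′ w a s′a) (⊕-self s′ w)
                              x~a T′-x-y (∈∉⇒≢ s′a s′w)
  ... | is-leaf lw = conflict x a w (⊆-⊕ s′ w x s′x) (⊆-⊕ s′ w a s′a) (⊕-self s′ w)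
                              x~a (T′-x-leaf lw) (∈∉⇒≢ s′a s′w)
  ... | is-core cw with new-core-conflict d cw w≢t (blocked w sw)
    where
    sw : s w ≡ false
    sw = ¬-not λ sw → not-¬ (s⊆s′ w cw sw) s′w
  ...   | inj₁ cc          = core-conflict⇒T′ ⊕w-mono cc
    where
    ⊕w-mono : s ⊕ w ⊆ᶜ s′ ⊕ w
    ⊕w-mono z cz z∈ with ⊕-cases s w z∈
    ... | inj₁ refl = ⊕-self s′ z
    ... | inj₂ sz   = ⊆-⊕ s′ w z (s⊆s′ z cz sz)
  ...   | inj₂ (t~w , st) = near-t (cw , t~w) st

  leaves-∈ : ∀ {s u} → MaximalDissociated T s → s x ≡ false → Leaf u → s u ≡ true
  leaves-∈ m sx lu = pendant-∈ (leaf-nbr lu) m sx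

  y-∈ : ∀ {s} → MaximalDissociated T s → s t ≡ false → s y ≡ true
  y-∈ = pendant-∈ y-pendant

  some-leaf-∈ : ∀ {s} → MaximalDissociated T s → s x ≡ true → s t ≡ false → ∃ λ u → Leaf u × s u ≡ true
  some-leaf-∈ {s} (d , blocked) sx st with s u₀ ≟ᵇ true
  ... | yes su₀ = u₀ , u₀-leaf , su₀
  ... | no su₀≢ with conflict-through-new T irreflexive d (blocked u₀ (¬-not su₀≢))
  ...   | centre _ _ _ _ u₀~a u₀~b a≢b =
    ⊥-elim (a≢b (trans (leaf-nbr u₀-leaf u₀~a) (sym (leaf-nbr u₀-leaf u₀~b))))
  ...   | end _ b _ sb v~u₀ v~b _ with leaf-nbr u₀-leaf (adj-sym v~u₀)
  ...     | refl = b , (v~b , ∈∉⇒≢ sb st) , sb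

  x-t-y-∉ : ∀ {s} → Dissociated T s → s x ≡ true → s t ≡ true → s y ≡ true → ⊥
  x-t-y-∉ d sx st sy = d (conflict t x y st sx sy (adj-sym x~t) t~y x≢y)

  Nt-∉ : ∀ {s z} → Dissociated T s → s x ≡ true → s t ≡ true → Nt z → s z ≡ false
  Nt-∉ d sx st (cz , t~z) = ¬-not λ sz → d (conflict t x _ st sx sz (adj-sym x~t) t~z (≢-sym (core≢x cz)))

  leaves-∉ : ∀ {s z} → Dissociated T s → s x ≡ true → s t ≡ true → Leaf z → s z ≡ false
  leaves-∉ d sx st (x~z , z≢t) = ¬-not λ sz → d (conflict x t _ sx st sz x~t x~z (≢-sym z≢t))

  maximal-x∉ : ∀ {s} → MaximalDissociated T s → s x ≡ false → MaximalDissociated T′ s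
  maximal-x∉ {s} m@(d , blocked) sx = d ∘ conflict-transfer T′≡T sx , blocked′
    where
    blocked′ : ∀ w → s w ≡ false → Conflict T′ (s ⊕ w)
    blocked′ w sw with w ≟ x
    ... | yes refl = conflict x u₀ u₁ (⊕-self s x) (⊆-⊕ s x u₀ (leaves-∈ m sx u₀-leaf))
                              (⊆-⊕ s x u₁ (leaves-∈ m sx u₁-leaf)) (T′-x-leaf u₀-leaf) (T′-x-leaf u₁-leaf) u₀≢u₁
    ... | no w≢x   = conflict-transfer (λ a≢x b≢x → sym (T′≡T a≢x b≢x)) (trans (⊕-other s (≢-sym w≢x)) sx)
                                       (blocked w sw)

  drop-y-dissociated : ∀ {s} → Dissociated T s → s x ≡ true → Dissociated T′ (s ⊖ y)
  drop-y-dissociated {s} d sx c with classify-T′-conflict c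
  ... | off-x c′                                = d (conflict-mono T (λ z → ⊖-⊆ s y z ∘ ⊖-⊆ (s ⊖ y) x z) c′)
  ... | at-x _ _ _   sa _  (inj₁ refl) _        = not-¬ sa (⊖-self s y)
  ... | at-x _ _ _   _  sb (inj₂ _) (inj₁ refl) = not-¬ sb (⊖-self s y)
  ... | at-x a b a≢b sa sb (inj₂ la) (inj₂ lb)  =
    d (conflict x a b sx (⊖-⊆ s y a sa) (⊖-⊆ s y b sb) (proj₁ la) (proj₁ lb) a≢b)
  ... | at-y sy _                               = not-¬ sy (⊖-self s y)

  move-y-to-t-maximal : ∀ {s} → MaximalDissociated T s → s x ≡ true → s t ≡ false →
                        ¬ MaximalDissociated T′ (s ⊖ y) → MaximalDissociated T′ (s ⊖ y ⊕ t)
  move-y-to-t-maximal {s} m sx st ¬m′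
    with some-leaf-∈ m sx st | ¬maximal⇒extensible T′ (drop-y-dissociated (proj₁ m) sx) ¬m′
  ... | u , lu , su | w , w∉ , d′ = go (w ≟ t)
    where
    s′ : Subsetᶠ n
    s′ = s ⊖ y
    s′x : s′ x ≡ true
    s′x = trans (⊖-other s x≢y) sx
    s′u : s′ u ≡ true
    s′u = trans (⊖-other s (leaf≢y lu)) su
    s⊆s′ : s ⊆ᶜ s′
    s⊆s′ z cz sz = trans (⊖-other s (core≢y cz)) sz
    t∉s : ∀ {A : Set} {z} → Nt z → s t ≡ true → A
    t∉s _ st′ = ⊥-elim (not-¬ st′ st)
    go : Dec (w ≡ t) → MaximalDissociated T′ (s′ ⊕ t)
    go (no w≢t)   = ⊥-elim (d′ (blocked-in-T′ m s⊆s′ s′x s′u (T′-x-leaf lu) w∉ w≢t t∉s))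
    go (yes refl) = d′ , λ w′ w′∉ →
      blocked-in-T′ m (λ z cz sz → ⊆-⊕ s′ w z (s⊆s′ z cz sz)) (⊆-⊕ s′ w x s′x) (⊆-⊕ s′ w u s′u) (T′-x-leaf lu)
                    w′∉ (λ { refl → not-¬ (⊕-self s′ w) w′∉ }) t∉s

  add-leaf-dissociated : ∀ {s} → Dissociated T s → s x ≡ true → s t ≡ true → s y ≡ false →
                         Dissociated T′ (s ⊕ u₁)
  add-leaf-dissociated {s} d sx st sy c with classify-T′-conflict c
  ... | off-x c′ = pendant-addable (leaf-nbr u₁-leaf) (d ∘ conflict-mono T (⊖-⊆ s x)) (⊖-self s x)
                     (conflict-mono T (≗⇒⊆ᶠ (⊕⊖-comm s (≢-sym (leaf≢x u₁-leaf)))) c′)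
  ... | at-x _ _ a≢b sa sb a-y∨leaf b-y∨leaf = a≢b (trans (only-u₁ sa a-y∨leaf) (sym (only-u₁ sb b-y∨leaf)))
    where
    only-u₁ : ∀ {z} → (s ⊕ u₁) z ≡ true → z ≡ y ⊎ Leaf z → z ≡ u₁
    only-u₁ z∈ (inj₁ refl) = ⊥-elim (not-¬ (⊕-∈⁻ s u₁ z∈ (≢-sym (leaf≢y u₁-leaf))) sy)
    only-u₁ z∈ (inj₂ lz) with ⊕-cases s u₁ z∈
    ... | inj₁ z≡u₁ = z≡u₁
    ... | inj₂ sz   = ⊥-elim (not-¬ sz (leaves-∉ d sx st lz))
  ... | at-y sy′ _ = not-¬ (⊕-∈⁻ s u₁ sy′ (≢-sym (leaf≢y u₁-leaf))) sy

  Extra : Subsetᶠ n → Fin n → Set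
  Extra s v = Nt v × Dissociated T′ (s ⊕ v ⊕ u₁)

  extra-vertex : ∀ {s} → MaximalDissociated T s → s x ≡ true → s t ≡ true → s y ≡ false →
                 ¬ MaximalDissociated T′ (s ⊕ u₁) → ∃ (Extra s)
  extra-vertex {s} m sx st sy ¬m′ with ¬maximal⇒extensible T′ (add-leaf-dissociated (proj₁ m) sx st sy) ¬m′
  ... | w , w∉ , d′ with nt? w
  ...   | yes w∈Nt = w , w∈Nt , d′ ∘ conflict-mono T′ (≗⇒⊆ᶠ (⊕-comm s w u₁))
  ...   | no w∉Nt  = ⊥-elim (d′ (blocked-in-T′ m (λ z _ → ⊆-⊕ s u₁ z) (⊆-⊕ s u₁ x sx) (⊕-self s u₁)
                                                (T′-x-leaf u₁-leaf) w∉ (λ { refl → not-¬ (⊆-⊕ s u₁ t st) w∉ })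
                                                (λ w∈Nt _ → ⊥-elim (w∉Nt w∈Nt))))

  add-extra-and-leaf-maximal : ∀ {s v} → MaximalDissociated T s → s x ≡ true → s t ≡ true → Extra s v →
                               MaximalDissociated T′ (s ⊕ v ⊕ u₁)
  add-extra-and-leaf-maximal {s} {v} m sx st (v∈Nt@(cv , t~v) , d′) = d′ , blocked
    where
    h : Subsetᶠ n
    h = s ⊕ v ⊕ u₁
    s⊆h : s ⊆ᶠ h
    s⊆h z sz = ⊆-⊕ (s ⊕ v) u₁ z (⊆-⊕ s v z sz)
    hv : h v ≡ true
    hv = ⊆-⊕ (s ⊕ v) u₁ v (⊕-self s v)
    blocked : ∀ w → h w ≡ false → Conflict T′ (h ⊕ w)
    blocked w w∉ = blocked-in-T′ m (λ z _ → s⊆h z) (s⊆h x sx) (⊕-self (s ⊕ v) u₁) (T′-x-leaf u₁-leaf) w∉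
                     (λ { refl → not-¬ (s⊆h t st) w∉ }) near-t
      where
      near-t : Nt w → s t ≡ true → Conflict T′ (h ⊕ w)
      near-t (cw , t~w) _ = conflict t v w (⊆-⊕ h w t (s⊆h t st)) (⊆-⊕ h w v hv) (⊕-self h w)
                              (trans (T′-core t-core cv) t~v) (trans (T′-core t-core cw) t~w) (∈∉⇒≢ hv w∉)

  strip-leaves-maximal : ∀ {P} → MaximalDissociated T P → P x ≡ true → P y ≡ true → P t ≡ false →
                         MaximalDissociated T′ (P ∖ leaf?)
  strip-leaves-maximal {P} m@(d , _) px py pt = dissociated , blocked
    where
    Q : Subsetᶠ n
    Q = P ∖ leaf?
    Qx : Q x ≡ true
    Qx = trans (∖-keeps P leaf? (λ lx → leaf≢x lx refl)) px
    Qy : Q y ≡ true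
    Qy = trans (∖-keeps P leaf? (λ ly → leaf≢y ly refl)) py
    dissociated : Dissociated T′ Q
    dissociated c with classify-T′-conflict c
    ... | off-x c′                                   = d (conflict-mono T (λ z → ∖-⊆ P leaf? z ∘ ⊖-⊆ Q x z) c′)
    ... | at-x _ _ _   qa _  (inj₂ la) _             = not-¬ qa (∖-excludes P leaf? la)
    ... | at-x _ _ _   _  qb (inj₁ _) (inj₂ lb)      = not-¬ qb (∖-excludes P leaf? lb)
    ... | at-x _ _ a≢b _  _  (inj₁ refl) (inj₁ refl) = a≢b refl
    ... | at-y _ qt                                  = not-¬ (∖-⊆ P leaf? t qt) pt
    blocked : ∀ w → Q w ≡ false → Conflict T′ (Q ⊕ w)
    blocked w qw = go (w ≟ t)
      where
      go : Dec (w ≡ t) → Conflict T′ (Q ⊕ w)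
      go (yes refl) = conflict y x w (⊆-⊕ Q w y Qy) (⊆-⊕ Q w x Qx) (⊕-self Q w) (T′-sym {x} T′-x-y) T′-y-t x≢t
      go (no w≢t)   = blocked-in-T′ m (λ z cz pz → trans (∖-keeps P leaf? (core⇒¬leaf cz)) pz)
                                      Qx Qy T′-x-y qw w≢t (λ _ pt′ → ⊥-elim (not-¬ pt′ pt))

  -- The injection Φ(T) → Φ(T′), by cases on which of x, t, y lie in s
  -- (t ∉ s forces y ∈ s, and x, t, y ∈ s is impossible).
  data Encoding (s : Subsetᶠ n) : Subsetᶠ n → Set where
    keep : s x ≡ false → Encoding s s
    drop-y : s x ≡ true → s t ≡ false → s y ≡ true →
             MaximalDissociated T′ (s ⊖ y) → Encoding s (s ⊖ y)
    move-y-to-t : s x ≡ true → s t ≡ false → s y ≡ true →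
                  ¬ MaximalDissociated T′ (s ⊖ y) → Encoding s (s ⊖ y ⊕ t)
    move-t-to-y : s x ≡ true → s t ≡ true → s y ≡ false →
                  MaximalDissociated T′ (s ⊖ t ⊕ y) → Encoding s (s ⊖ t ⊕ y)
    add-leaf : s x ≡ true → s t ≡ true → s y ≡ false →
               ¬ MaximalDissociated T′ (s ⊖ t ⊕ y) → MaximalDissociated T′ (s ⊕ u₁) → Encoding s (s ⊕ u₁)
    add-extra-move-t-to-y : s x ≡ true → s t ≡ true → s y ≡ false → ∀ {v} → Extra s v →
                            MaximalDissociated T′ (s ⊕ v ⊖ t ⊕ y) → Encoding s (s ⊕ v ⊖ t ⊕ y)
    add-extra-and-leaf : s x ≡ true → s t ≡ true → s y ≡ false → ∀ {v} → Extra s v →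
                         ¬ MaximalDissociated T′ (s ⊕ v ⊖ t ⊕ y) → Encoding s (s ⊕ v ⊕ u₁)

  encode : ∀ {s} → MaximalDissociated T s → ∃ (Encoding s)
  encode {s} m with s x in sx | s t in st | s y in sy
  ... | false | _     | _     = s , keep sx
  ... | true  | false | false = ⊥-elim (not-¬ (y-∈ m st) sy)
  ... | true  | true  | true  = ⊥-elim (x-t-y-∉ (proj₁ m) sx st sy)
  ... | true  | false | true  with maximal? T′ (s ⊖ y)
  ...   | yes m′ = _ , drop-y sx st sy m′
  ...   | no ¬m′ = _ , move-y-to-t sx st sy ¬m′
  encode {s} m | true | true | false with maximal? T′ (s ⊖ t ⊕ y) | maximal? T′ (s ⊕ u₁)
  ...   | yes m′ | _      = _ , move-t-to-y sx st sy m′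
  ...   | no ¬m′ | yes m″ = _ , add-leaf sx st sy ¬m′ m″
  ...   | no _   | no ¬m″ with extra-vertex m sx st sy ¬m″
  ...     | v , extra with maximal? T′ (s ⊕ v ⊖ t ⊕ y)
  ...       | yes m‴ = _ , add-extra-move-t-to-y sx st sy extra m‴
  ...       | no ¬m‴ = _ , add-extra-and-leaf sx st sy extra ¬m‴

  encoding-maximal : ∀ {s h} → MaximalDissociated T s → Encoding s h → MaximalDissociated T′ h
  encoding-maximal m (keep sx)                             = maximal-x∉ m sx
  encoding-maximal m (drop-y _ _ _ m′)                     = m′
  encoding-maximal m (move-y-to-t sx st _ ¬m′)             = move-y-to-t-maximal m sx st ¬m′
  encoding-maximal m (move-t-to-y _ _ _ m′)                = m′
  encoding-maximal m (add-leaf _ _ _ _ m′)                 = m′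
  encoding-maximal m (add-extra-move-t-to-y _ _ _ _ m′)    = m′
  encoding-maximal m (add-extra-and-leaf sx st _ extra _)  = add-extra-and-leaf-maximal m sx st extra

  private
    decode-x-t : (h : Subsetᶠ n) → Dec (MaximalDissociated T (h ⊖ t ⊕ y)) → Subsetᶠ n
    decode-x-t h (yes _) = h ⊖ t ⊕ y
    decode-x-t h (no _)  = h ∖ nt? ⊖ u₁

    decode-by : Subsetᶠ n → Bool → Bool → Bool → Subsetᶠ n
    decode-by h false _     _     = h
    decode-by h true  false false = h ⊕ y
    decode-by h true  false true  = h ∖ nt? ⊖ y ⊕ t
    decode-by h true  true  false = decode-x-t h (maximal? T (h ⊖ t ⊕ y))
    decode-by h true  true  true  = h

  -- In the case x, t ∈ h ∌ y, the T-maximality of h ⊖ t ⊕ y tells move-y-to-t apart from the add-leaf cases.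
  decode : Subsetᶠ n → Subsetᶠ n
  decode h = decode-by h (h x) (h t) (h y)

  decode-cong : ∀ {h h′} → h ≗ h′ → decode h ≗ decode h′
  decode-cong {h} {h′} h≗h′ z rewrite h≗h′ x | h≗h′ t | h≗h′ y = by-cong (h′ x) (h′ t) (h′ y) z
    where
    x-t-cong : ∀ d d′ → decode-x-t h d ≗ decode-x-t h′ d′
    x-t-cong (yes _)   (yes _)    = ⊕-cong y (⊖-cong t h≗h′)
    x-t-cong (no _)    (no _)     = ⊖-cong u₁ (∖-cong nt? h≗h′)
    x-t-cong (yes mT)  (no ¬mT′)  = ⊥-elim (¬mT′ (maximal-resp-≗ T (⊕-cong y (⊖-cong t h≗h′)) mT))
    x-t-cong (no ¬mT)  (yes mT′)  = ⊥-elim (¬mT (maximal-resp-≗ T (⊕-cong y (⊖-cong t (sym ∘ h≗h′))) mT′))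
    by-cong : ∀ bx bt by → decode-by h bx bt by ≗ decode-by h′ bx bt by
    by-cong false _     _     = h≗h′
    by-cong true  false false = ⊕-cong y h≗h′
    by-cong true  false true  = ⊕-cong t (⊖-cong y (∖-cong nt? h≗h′))
    by-cong true  true  false = x-t-cong (maximal? T (h ⊖ t ⊕ y)) (maximal? T (h′ ⊖ t ⊕ y))
    by-cong true  true  true  = h≗h′

  decode-x∉ : ∀ {h} → h x ≡ false → decode h ≗ h
  decode-x∉ hx z rewrite hx = refl

  decode-y∉ : ∀ {h} → h x ≡ true → h t ≡ false → h y ≡ false → decode h ≗ h ⊕ y
  decode-y∉ hx ht hy z rewrite hx | ht | hy = refl

  decode-y∈ : ∀ {h} → h x ≡ true → h t ≡ false → h y ≡ true → decode h ≗ h ∖ nt? ⊖ y ⊕ t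
  decode-y∈ hx ht hy z rewrite hx | ht | hy = refl

  decode-t∈-maximal : ∀ {h} → h x ≡ true → h t ≡ true → h y ≡ false →
                      MaximalDissociated T (h ⊖ t ⊕ y) → decode h ≗ h ⊖ t ⊕ y
  decode-t∈-maximal {h} hx ht hy mT z rewrite hx | ht | hy with maximal? T (h ⊖ t ⊕ y)
  ... | yes _  = refl
  ... | no ¬mT = ⊥-elim (¬mT mT)

  decode-t∈-¬maximal : ∀ {h} → h x ≡ true → h t ≡ true → h y ≡ false →
                       ¬ MaximalDissociated T (h ⊖ t ⊕ y) → decode h ≗ h ∖ nt? ⊖ u₁
  decode-t∈-¬maximal {h} hx ht hy ¬mT z rewrite hx | ht | hy with maximal? T (h ⊖ t ⊕ y)
  ... | yes mT = ⊥-elim (¬mT mT)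
  ... | no _   = refl

  -- b is s or s ⊕ v for an extra core neighbour v of t; when x, t ∈ s the codes are b ⊖ t ⊕ y and b ⊕ u₁.
  record Base (s b : Subsetᶠ n) : Set where
    field
      x∈        : b x ≡ true
      t∈        : b t ≡ true
      y∉        : b y ≡ false
      no-leaves : ∀ {z} → Leaf z → b z ≡ false
      strips-to : b ∖ nt? ≗ s

  self-base : ∀ {s} → Dissociated T s → s x ≡ true → s t ≡ true → s y ≡ false → Base s s
  self-base d sx st sy = record
    { x∈ = sx ; t∈ = st ; y∉ = sy
    ; no-leaves = leaves-∉ d sx st
    ; strips-to = ∖-avoids nt? (λ _ → Nt-∉ d sx st)
    }

  extra-base : ∀ {s v} → Dissociated T s → s x ≡ true → s t ≡ true → s y ≡ false → Nt v → Base s (s ⊕ v)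
  extra-base {s} {v} d sx st sy v∈Nt = record
    { x∈        = ⊆-⊕ s v x sx
    ; t∈        = ⊆-⊕ s v t st
    ; y∉        = trans (⊕-other s (λ { refl → ¬Nt-y v∈Nt })) sy
    ; no-leaves = λ lz → trans (⊕-other s (λ { refl → ¬Nt-leaf lz v∈Nt })) (leaves-∉ d sx st lz)
    ; strips-to = λ z → trans (∖-⊕-inside s nt? v∈Nt z) (∖-avoids nt? (λ _ → Nt-∉ d sx st) z)
    }

  decode-moved : ∀ {s b} → Base s b → s t ≡ true → s y ≡ false → decode (b ⊖ t ⊕ y) ≗ s
  decode-moved {s} {b} base st sy = begin
      decode h               ≈⟨ decode-y∈ hx ht hy ⟩
      h ∖ nt? ⊖ y ⊕ t        ≈⟨ ⊕-cong t (⊖-cong y strip-h) ⟩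
      s ⊖ t ⊕ y ⊖ y ⊕ t      ≈⟨ ⊖⊕⊖⊕-cancel st sy t≢y ⟩
      s                      ∎
    where
    open Base base
    open ≗-Reasoning
    h : Subsetᶠ n
    h = b ⊖ t ⊕ y
    hx : h x ≡ true
    hx = trans (⊕-other (b ⊖ t) x≢y) (trans (⊖-other b x≢t) x∈)
    ht : h t ≡ false
    ht = trans (⊕-other (b ⊖ t) t≢y) (⊖-self b t)
    hy : h y ≡ true
    hy = ⊕-self (b ⊖ t) y
    strip-h : h ∖ nt? ≗ s ⊖ t ⊕ y
    strip-h = begin
      b ⊖ t ⊕ y ∖ nt?        ≈⟨ ∖-⊕-outside (b ⊖ t) nt? ¬Nt-y ⟩
      (b ⊖ t ∖ nt?) ⊕ y      ≈⟨ ⊕-cong y (∖-⊖ b nt? t) ⟩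
      (b ∖ nt?) ⊖ t ⊕ y      ≈⟨ ⊕-cong y (⊖-cong t strips-to) ⟩
      s ⊖ t ⊕ y              ∎

  decode-leaf : ∀ {s b} → Base s b → s u₁ ≡ false → ¬ MaximalDissociated T′ (b ⊖ t ⊕ y) →
                decode (b ⊕ u₁) ≗ s
  decode-leaf {s} {b} base su₁ ¬m′ = begin
      decode h               ≈⟨ decode-t∈-¬maximal hx ht hy ¬mT ⟩
      h ∖ nt? ⊖ u₁           ≈⟨ ⊖-cong u₁ (∖-⊕-outside b nt? (¬Nt-leaf u₁-leaf)) ⟩
      (b ∖ nt?) ⊕ u₁ ⊖ u₁    ≈⟨ ⊖-cong u₁ (⊕-cong u₁ strips-to) ⟩
      s ⊕ u₁ ⊖ u₁            ≈⟨ ⊕⊖-cancel su₁ ⟩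
      s                      ∎
    where
    open Base base
    open ≗-Reasoning
    h : Subsetᶠ n
    h = b ⊕ u₁
    hx : h x ≡ true
    hx = trans (⊕-other b (≢-sym (leaf≢x u₁-leaf))) x∈
    ht : h t ≡ true
    ht = trans (⊕-other b (≢-sym u₁≢t)) t∈
    hy : h y ≡ false
    hy = trans (⊕-other b (≢-sym (leaf≢y u₁-leaf))) y∉
    strip-leaves : h ⊖ t ⊕ y ∖ leaf? ≗ b ⊖ t ⊕ y
    strip-leaves = begin
      b ⊕ u₁ ⊖ t ⊕ y ∖ leaf?     ≈⟨ ∖-⊕-outside (b ⊕ u₁ ⊖ t) leaf? (λ ly → leaf≢y ly refl) ⟩
      (b ⊕ u₁ ⊖ t ∖ leaf?) ⊕ y   ≈⟨ ⊕-cong y (∖-⊖ (b ⊕ u₁) leaf? t) ⟩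
      (b ⊕ u₁ ∖ leaf?) ⊖ t ⊕ y   ≈⟨ ⊕-cong y (⊖-cong t (∖-⊕-inside b leaf? u₁-leaf)) ⟩
      (b ∖ leaf?) ⊖ t ⊕ y        ≈⟨ ⊕-cong y (⊖-cong t (∖-avoids leaf? (λ _ → no-leaves))) ⟩
      b ⊖ t ⊕ y                  ∎
    ¬mT : ¬ MaximalDissociated T (h ⊖ t ⊕ y)
    ¬mT mT = ¬m′ (maximal-resp-≗ T′ strip-leaves (strip-leaves-maximal mT
      (trans (⊕-other (h ⊖ t) x≢y) (trans (⊖-other h x≢t) hx)) (⊕-self (h ⊖ t) y)
      (trans (⊕-other (h ⊖ t) t≢y) (⊖-self h t))))

  decode-encoding : ∀ {s h} → MaximalDissociated T s → Encoding s h → decode h ≗ s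
  decode-encoding _ (keep sx) = decode-x∉ sx
  decode-encoding {s} _ (drop-y sx st sy _) = begin
      decode (s ⊖ y)   ≈⟨ decode-y∉ (trans (⊖-other s x≢y) sx) (trans (⊖-other s t≢y) st) (⊖-self s y) ⟩
      s ⊖ y ⊕ y        ≈⟨ ⊖⊕-cancel sy ⟩
      s                ∎
    where open ≗-Reasoning
  decode-encoding {s} m (move-y-to-t sx st sy _) = begin
      decode h         ≈⟨ decode-t∈-maximal hx ht hy (maximal-resp-≗ T (sym ∘ restored) m) ⟩
      h ⊖ t ⊕ y        ≈⟨ restored ⟩
      s                ∎
    where
    open ≗-Reasoning
    h : Subsetᶠ n
    h = s ⊖ y ⊕ t
    restored : h ⊖ t ⊕ y ≗ s
    restored = ⊖⊕⊖⊕-cancel sy st (≢-sym t≢y)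
    hx : h x ≡ true
    hx = trans (⊕-other (s ⊖ y) x≢t) (trans (⊖-other s x≢y) sx)
    ht : h t ≡ true
    ht = ⊕-self (s ⊖ y) t
    hy : h y ≡ false
    hy = trans (⊕-other (s ⊖ y) (≢-sym t≢y)) (⊖-self s y)
  decode-encoding (d , _) (move-t-to-y sx st sy _) =
    decode-moved (self-base d sx st sy) st sy
  decode-encoding (d , _) (add-leaf sx st sy ¬m′ _) =
    decode-leaf (self-base d sx st sy) (leaves-∉ d sx st u₁-leaf) ¬m′
  decode-encoding (d , _) (add-extra-move-t-to-y sx st sy (v∈Nt , _) _) =
    decode-moved (extra-base d sx st sy v∈Nt) st sy
  decode-encoding (d , _) (add-extra-and-leaf sx st sy (v∈Nt , _) ¬m′) =
    decode-leaf (extra-base d sx st sy v∈Nt) (leaves-∉ d sx st u₁-leaf) ¬m′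

  -- No maximal dissociation set of T′ containing x, y, q and r is a code.
  record Fork : Set where
    field
      q r    : Fin n
      q∈Nt   : Nt q
      r-core : Core r
      r≢t    : r ≢ t
      r≢q    : r ≢ q
      r-nbr  : T t r ≡ true ⊎ T q r ≡ true

  private
    Far : Fin n → Set
    Far z = Core z × z ≢ t × ¬ (T t z ≡ true)

    far? : Decidable Far
    far? z = core? z ×-dec ¬? (z ≟ t) ×-dec ¬? (T t z ≟ᵇ true)

    -- Where a walk from r to t first leaves the far vertices, it steps from some p to a core neighbour q of t.
    fork-from-far : Connected T → ∀ {r} → Far r → Fork
    fork-from-far connected {r} far-r with walk-exits far? (connected r t) far-r (λ (_ , t≢t , _) → t≢t refl)
    ... | p , q , (cp , p≢t , ¬t~p) , ¬far-q , p~q = record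
      { q = q ; r = p ; q∈Nt = cq , t~q ; r-core = cp ; r≢t = p≢t ; r≢q = adj⇒≢ p~q ; r-nbr = inj₂ (adj-sym p~q) }
      where
      cq : Core q
      cq = core-nbr-off-t cp p≢t p~q
      t~q : T t q ≡ true
      t~q with T t q ≟ᵇ true
      ... | yes t~q = t~q
      ... | no ¬t~q = ⊥-elim (¬far-q (cq , (λ { refl → ¬t~p (adj-sym p~q) }) , ¬t~q))

  fork : Connected T → ∀ {w₁ w₂} → Core w₁ → w₁ ≢ t → Core w₂ → w₂ ≢ t → w₁ ≢ w₂ → Fork
  fork connected {w₁} {w₂} c₁ w₁≢t c₂ w₂≢t w₁≢w₂ with T t w₁ ≟ᵇ true | T t w₂ ≟ᵇ true
  ... | yes t~w₁ | yes t~w₂ = record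
    { q = w₁ ; r = w₂ ; q∈Nt = c₁ , t~w₁ ; r-core = c₂ ; r≢t = w₂≢t ; r≢q = ≢-sym w₁≢w₂
    ; r-nbr = inj₁ t~w₂ }
  ... | yes _    | no ¬t~w₂ = fork-from-far connected (c₂ , w₂≢t , ¬t~w₂)
  ... | no ¬t~w₁ | _        = fork-from-far connected (c₁ , w₁≢t , ¬t~w₁)

  module Witness (f : Fork) where

    open Fork f

    seed : Subsetᶠ n
    seed = const false ⊕ q ⊕ r ⊕ x ⊕ y

    private
      seed-member : ∀ {z} → seed z ≡ true → z ≡ q ⊎ z ≡ r ⊎ z ≡ x ⊎ z ≡ y
      seed-member z∈ with ⊕-cases _ y z∈
      ... | inj₁ z≡y = inj₂ (inj₂ (inj₂ z≡y))
      ... | inj₂ z∈′ with ⊕-cases _ x z∈′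
      ...   | inj₁ z≡x = inj₂ (inj₂ (inj₁ z≡x))
      ...   | inj₂ z∈″ with ⊕-cases _ r z∈″
      ...     | inj₁ z≡r = inj₂ (inj₁ z≡r)
      ...     | inj₂ z∈‴ with ⊕-cases _ q z∈‴
      ...       | inj₁ z≡q = inj₁ z≡q
      ...       | inj₂ ()

      q-core : Core q
      q-core = proj₁ q∈Nt

      t∉seed : ∀ {z} → seed z ≡ true → z ≢ t
      t∉seed z∈ refl with seed-member z∈
      ... | inj₁ t≡q               = ¬Nt-t (subst Nt (sym t≡q) q∈Nt)
      ... | inj₂ (inj₁ t≡r)        = r≢t (sym t≡r)
      ... | inj₂ (inj₂ (inj₁ t≡x)) = x≢t (sym t≡x)
      ... | inj₂ (inj₂ (inj₂ t≡y)) = t≢y t≡y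

      seed-no-leaves : ∀ {z} → seed z ≡ true → ¬ Leaf z
      seed-no-leaves z∈ lz with seed-member z∈
      ... | inj₁ refl               = core⇒¬leaf q-core lz
      ... | inj₂ (inj₁ refl)        = core⇒¬leaf r-core lz
      ... | inj₂ (inj₂ (inj₁ refl)) = leaf≢x lz refl
      ... | inj₂ (inj₂ (inj₂ refl)) = leaf≢y lz refl

      only-y : ∀ {z} → seed z ≡ true → z ≡ y ⊎ Leaf z → z ≡ y
      only-y _  (inj₁ z≡y) = z≡y
      only-y z∈ (inj₂ lz)  = ⊥-elim (seed-no-leaves z∈ lz)

      q-or-r : ∀ {z} → (seed ⊖ x) z ≡ true → z ≢ y → z ≡ q ⊎ z ≡ r
      q-or-r {z} z∈ z≢y with seed-member (⊖-⊆ seed x z z∈)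
      ... | inj₁ z≡q               = inj₁ z≡q
      ... | inj₂ (inj₁ z≡r)        = inj₂ z≡r
      ... | inj₂ (inj₂ (inj₁ refl)) = ⊥-elim (not-¬ z∈ (⊖-self seed x))
      ... | inj₂ (inj₂ (inj₂ z≡y)) = ⊥-elim (z≢y z≡y)

      pigeonhole : ∀ {v a b : Fin n} → v ≡ q ⊎ v ≡ r → a ≡ q ⊎ a ≡ r → b ≡ q ⊎ b ≡ r →
                   v ≢ a → v ≢ b → a ≢ b → ⊥
      pigeonhole (inj₁ refl) (inj₁ refl) _           v≢a _   _   = v≢a refl
      pigeonhole (inj₂ refl) (inj₂ refl) _           v≢a _   _   = v≢a refl
      pigeonhole (inj₁ refl) (inj₂ refl) (inj₁ refl) _   v≢b _   = v≢b refl
      pigeonhole (inj₁ refl) (inj₂ refl) (inj₂ refl) _   _   a≢b = a≢b refl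
      pigeonhole (inj₂ refl) (inj₁ refl) (inj₁ refl) _   _   a≢b = a≢b refl
      pigeonhole (inj₂ refl) (inj₁ refl) (inj₂ refl) _   v≢b _   = v≢b refl

    seed-dissociated : Dissociated T′ seed
    seed-dissociated c with classify-T′-conflict c
    ... | at-x _ _ a≢b sa sb a-y∨leaf b-y∨leaf = a≢b (trans (only-y sa a-y∨leaf) (sym (only-y sb b-y∨leaf)))
    ... | at-y _ st = t∉seed st refl
    ... | off-x (conflict v a b sv sa sb v~a v~b a≢b) =
      pigeonhole (q-or-r sv v≢y) (q-or-r sa (end≢y v~a sv)) (q-or-r sb (end≢y v~b sv))
                 (adj⇒≢ v~a) (adj⇒≢ v~b) a≢b
      where
      present : ∀ {z} → (seed ⊖ x) z ≡ true → z ≢ t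
      present z∈ = t∉seed (⊖-⊆ seed x _ z∈)
      v≢y : v ≢ y
      v≢y refl = present sa (y-pendant v~a)
      end≢y : ∀ {e} → T v e ≡ true → (seed ⊖ x) v ≡ true → e ≢ y
      end≢y v~e v∈ refl = present v∈ (y-pendant (adj-sym v~e))

    private
      extension : ∃[ m ] seed ⊆ᶠ m × MaximalDissociated T′ m
      extension = dissociated⇒⊆maximal T′ seed-dissociated

    Z : Subsetᶠ n
    Z = proj₁ extension

    Z-maximal : MaximalDissociated T′ Z
    Z-maximal = proj₂ (proj₂ extension)

    private
      Z∋ : ∀ z → seed z ≡ true → Z z ≡ true
      Z∋ = proj₁ (proj₂ extension)

      Zx : Z x ≡ true
      Zx = Z∋ x (⊆-⊕ _ y x (⊕-self _ x))

      Zy : Z y ≡ true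
      Zy = Z∋ y (⊕-self _ y)

      Zq : Z q ≡ true
      Zq = Z∋ q (⊆-⊕ _ y q (⊆-⊕ _ x q (⊆-⊕ _ r q (⊕-self _ q))))

      Zr : Z r ≡ true
      Zr = Z∋ r (⊆-⊕ _ y r (⊆-⊕ _ x r (⊕-self _ r)))

      Zt : Z t ≡ false
      Zt = ¬-not λ Zt → proj₁ Z-maximal (conflict y x t Zy Zx Zt (T′-sym {x} T′-x-y) T′-y-t x≢t)

    private
      extra-excludes-fork : ∀ {s v} → Dissociated T s → s x ≡ true → s t ≡ true → Extra s v →
                            (s ⊕ v) q ≡ true → (s ⊕ v) r ≡ true → ⊥
      extra-excludes-fork {s} d sx st (v∈Nt , d′) q∈ r∈ with ⊕-cases s _ q∈
      ... | inj₂ sq   = not-¬ sq (Nt-∉ d sx st q∈Nt)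
      ... | inj₁ refl = excluded r-nbr
        where
        sr : s r ≡ true
        sr = ⊕-∈⁻ s q r∈ r≢q
        in-code : ∀ {z} → s z ≡ true → (s ⊕ q ⊕ u₁) z ≡ true
        in-code {z} sz = ⊆-⊕ (s ⊕ q) u₁ z (⊆-⊕ s q z sz)
        excluded : T t r ≡ true ⊎ T q r ≡ true → ⊥
        excluded (inj₁ t~r) = not-¬ sr (Nt-∉ d sx st (r-core , t~r))
        excluded (inj₂ q~r) = d′ (conflict q t r (⊆-⊕ (s ⊕ q) u₁ q (⊕-self s q)) (in-code st) (in-code sr)
                                           (trans (T′-core q-core t-core) (adj-sym (proj₂ q∈Nt)))
                                           (trans (T′-core q-core r-core) q~r) (≢-sym r≢t))

    not-encoding : ∀ {s h} → MaximalDissociated T s → Encoding s h → h ≗ Z → ⊥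
    not-encoding {s} _ (keep sx) h≗Z = not-¬ (trans (h≗Z x) Zx) sx
    not-encoding {s} _ (drop-y _ _ _ _) h≗Z = not-¬ (trans (h≗Z y) Zy) (⊖-self s y)
    not-encoding {s} _ (move-y-to-t _ _ _ _) h≗Z = not-¬ (⊕-self (s ⊖ y) t) (trans (h≗Z t) Zt)
    not-encoding {s} (d , _) (move-t-to-y sx st _ _) h≗Z =
      not-¬ (⊖-⊆ s t q (⊕-∈⁻ (s ⊖ t) y (trans (h≗Z q) Zq) (core≢y q-core))) (Nt-∉ d sx st q∈Nt)
    not-encoding {s} _ (add-leaf _ st _ _ _) h≗Z = not-¬ (⊆-⊕ s u₁ t st) (trans (h≗Z t) Zt)
    not-encoding {s} (d , _) (add-extra-move-t-to-y sx st _ {v} extra _) h≗Z =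
      extra-excludes-fork d sx st extra (in-s⊕v Zq (core≢y q-core)) (in-s⊕v Zr (core≢y r-core))
      where
      in-s⊕v : ∀ {z} → Z z ≡ true → z ≢ y → (s ⊕ v) z ≡ true
      in-s⊕v {z} Zz z≢y = ⊖-⊆ (s ⊕ v) t z (⊕-∈⁻ (s ⊕ v ⊖ t) y (trans (h≗Z z) Zz) z≢y)
    not-encoding {s} _ (add-extra-and-leaf _ st _ {v} _ _) h≗Z =
      not-¬ (⊆-⊕ (s ⊕ v) u₁ t (⊆-⊕ s v t st)) (trans (h≗Z t) Zt)

  private
    encodeᶠ : Subsetᶠ n → Subsetᶠ n
    encodeᶠ s with maximal? T s
    ... | yes m = proj₁ (encode m)
    ... | no _  = s

    encodeᶠ-encoding : ∀ {s} → MaximalDissociated T s → Encoding s (encodeᶠ s)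
    encodeᶠ-encoding {s} m with maximal? T s
    ... | yes m′ = proj₂ (encode m′)
    ... | no ¬m  = ⊥-elim (¬m m)

    encodeᵛ decodeᵛ : Subset n → Subset n
    encodeᵛ S = tabulate (encodeᶠ (lookup S))
    decodeᵛ S = tabulate (decode (lookup S))

    encodeᵛ-maximal : ∀ {S} → IsMaximalDissociation T S → IsMaximalDissociation T′ (encodeᵛ S)
    encodeᵛ-maximal {S} mS = maximal⇒isMaximal T′ (encodeᵛ S)
      (maximal-resp-≗ T′ (sym ∘ lookup∘tabulate _) (encoding-maximal m (encodeᶠ-encoding m)))
      where
      m : MaximalDissociated T (lookup S)
      m = isMaximal⇒maximal T S mS

    decodeᵛ-encodeᵛ : ∀ {S} → IsMaximalDissociation T S → decodeᵛ (encodeᵛ S) ≡ S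
    decodeᵛ-encodeᵛ {S} mS = trans (tabulate-cong decoded) (tabulate∘lookup S)
      where
      m : MaximalDissociated T (lookup S)
      m = isMaximal⇒maximal T S mS
      decoded : decode (lookup (encodeᵛ S)) ≗ lookup S
      decoded z = trans (decode-cong (lookup∘tabulate _) z) (decode-encoding m (encodeᶠ-encoding m) z)

  Φ-≤ : Φ T ≤ Φ T′
  Φ-≤ = count≤-by-retraction (isMaximalDissociation? T) (isMaximalDissociation? T′) (allSubsets! n) ∈-allSubsets
          encodeᵛ decodeᵛ encodeᵛ-maximal decodeᵛ-encodeᵛ

  Φ-< : Fork → Φ T < Φ T′
  Φ-< f = count<-by-retraction (isMaximalDissociation? T) (isMaximalDissociation? T′) (allSubsets! n) ∈-allSubsets
            encodeᵛ decodeᵛ encodeᵛ-maximal decodeᵛ-encodeᵛ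
            (maximal⇒isMaximal T′ (tabulate Z) (maximal-resp-≗ T′ (sym ∘ lookup∘tabulate Z) Z-maximal)) missed
    where
    open Witness f
    missed : ∀ {S} → IsMaximalDissociation T S → encodeᵛ S ≢ tabulate Z
    missed {S} mS eq = not-encoding m (encodeᶠ-encoding m)
      λ z → trans (sym (lookup∘tabulate _ z)) (trans (cong (λ V → lookup V z) eq) (lookup∘tabulate Z z))
      where
      m : MaximalDissociated T (lookup S)
      m = isMaximal⇒maximal T S mS

two-avoiding : ∀ {n} {xs : List (Fin n)} → 3 ≤ length xs → Unique xs → ∀ t →
               ∃₂ λ a b → a ∈ₗ xs × b ∈ₗ xs × a ≢ b × a ≢ t × b ≢ t
two-avoiding {xs = a ∷ b ∷ c ∷ _} _ ((a≢b ∷ a≢c ∷ _) ∷ (b≢c ∷ _) ∷ _) t with a ≟ t | b ≟ t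
... | yes refl | _        = b , c , there (here refl) , there (there (here refl)) , b≢c , ≢-sym a≢b , ≢-sym a≢c
... | no a≢t   | yes refl = a , c , here refl , there (there (here refl)) , a≢c , a≢t , ≢-sym b≢c
... | no a≢t   | no b≢t   = a , b , here refl , there (here refl) , a≢b , a≢t , b≢t
two-avoiding {xs = _ ∷ []}     (s≤s ())             _ _
two-avoiding {xs = _ ∷ _ ∷ []} (s≤s (s≤s ()))       _ _

module _ {n : ℕ} {G : Adj n} where

  leaf-nbr-unique : ∀ {v a b} → IsLeaf G v → G v a ≡ true → G v b ≡ true → a ≡ b
  leaf-nbr-unique leaf = count≤1⇒≡ (λ w → _ ≟ᵇ true) (≤-reflexive leaf)

  nbrs-listed : ∀ {v zs} → deg G v ≤ length zs → Unique zs → (∀ {z} → z ∈ₗ zs → G v z ≡ true) →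
                ∀ {w} → G v w ≡ true → w ∈ₗ zs
  nbrs-listed = count≤length⇒∈ (λ w → _ ≟ᵇ true)

module Pendants {n k : ℕ} (T : Adj n) (simple : IsSimpleGraph T) (x t y : Fin n) (u : Fin k → Fin n)
  (u-injective : Injective _≡_ _≡_ u) (deg-x : deg T x ≡ suc k)
  (x~u : ∀ i → T x (u i) ≡ true) (u-leaf : ∀ i → IsLeaf T (u i))
  (x~t : T x t ≡ true) (t-nonleaf : ¬ IsLeaf T t) (t~y : T t y ≡ true) (y-leaf : IsLeaf T y)
  where

  open SimpleGraph simple

  u≢t : ∀ i → u i ≢ t
  u≢t i refl = t-nonleaf (u-leaf i)

  x-nbrs : ∀ {w} → T x w ≡ true → w ≡ t ⊎ ∃ λ i → u i ≡ w
  x-nbrs x~w with nbrs-listed {G = T} (≤-reflexive (trans deg-x (sym length-listed))) listed! listed-nbrs x~w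
    where
    listed : List (Fin n)
    listed = t ∷ map u (allFin k)
    length-listed : length listed ≡ suc k
    length-listed = cong suc (trans (length-map u (allFin k)) (length-tabulate id))
    listed! : Unique listed
    listed! = All.tabulate t∉ ∷ Unique.map⁺ u-injective (Unique.allFin⁺ k)
      where
      t∉ : ∀ {z} → z ∈ₗ map u (allFin k) → t ≢ z
      t∉ z∈ with ∈-map⁻ u z∈
      ... | i , _ , refl = ≢-sym (u≢t i)
    listed-nbrs : ∀ {z} → z ∈ₗ listed → T x z ≡ true
    listed-nbrs (here refl) = x~t
    listed-nbrs (there z∈) with ∈-map⁻ u z∈
    ... | i , _ , refl = x~u i
  ... | here w≡t = inj₁ w≡t
  ... | there w∈ with ∈-map⁻ u w∈
  ...   | i , _ , w≡ui = inj₂ (i , sym w≡ui)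

  x-pendants : ∀ {w} → T x w ≡ true → w ≢ t → ∀ {z} → T w z ≡ true → z ≡ x
  x-pendants x~w w≢t w~z with x-nbrs x~w
  ... | inj₁ w≡t      = ⊥-elim (w≢t w≡t)
  ... | inj₂ (i , refl) = leaf-nbr-unique {G = T} (u-leaf i) w~z (adj-sym (x~u i))

  y-pendant : ∀ {z} → T y z ≡ true → z ≡ t
  y-pendant y~z = leaf-nbr-unique {G = T} y-leaf y~z (adj-sym t~y)

  Outside : Fin n → Set
  Outside v = v ≢ x × v ≢ y × ¬ (∃ λ i → u i ≡ v)

  outside? : Decidable Outside
  outside? v = ¬? (v ≟ x) ×-dec (¬? (v ≟ y) ×-dec ¬? (any? (λ i → u i ≟ v)))

  outside⇒core : ∀ {v} → v ∈ₗ filter outside? (allFin n) → v ≢ x × v ≢ y × (T x v ≡ true → v ≡ t)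
  outside⇒core {v} v∈ with proj₂ (∈-filter⁻ outside? {xs = allFin n} v∈)
  ... | v≢x , v≢y , not-u = v≢x , v≢y , only-t
    where
    only-t : T x v ≡ true → v ≡ t
    only-t x~v with x-nbrs x~v
    ... | inj₁ v≡t = v≡t
    ... | inj₂ ui≡v = ⊥-elim (not-u ui≡v)

lemma2 : ∀ {n : ℕ} (T : Adj n) → IsTree T →
    (k : ℕ) → 2 ≤ k →
    (x t y : Fin n) (u : Fin k → Fin n) → Injective _≡_ _≡_ u →
    deg T x ≡ suc k →
    (∀ i → T x (u i) ≡ true) → (∀ i → IsLeaf T (u i)) →
    T x t ≡ true → ¬ IsLeaf T t →
    T t y ≡ true → IsLeaf T y →
    (Φ T ≤ Φ (replaceEdge T x t y))
    × (3 ≤ countOutside u x y → Φ T < Φ (replaceEdge T x t y))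
lemma2 {n} T tree (suc (suc k)) (s≤s (s≤s z≤n)) x t y u u-injective deg-x x~u u-leaf x~t t-nonleaf t~y y-leaf =
  Φ-≤ , Φ-<-outside
  where
  open IsTree tree
  open Pendants T simple x t y u u-injective deg-x x~u u-leaf x~t t-nonleaf t~y y-leaf
  open StarMove T simple x t y (u fzero) (u (fsuc fzero)) x~t t~y (x~u _) (x~u _)
         (λ u₀≡u₁ → 0≢1+n (u-injective u₀≡u₁)) (u≢t _) (u≢t _) x-pendants y-pendant
  Φ-<-outside : 3 ≤ countOutside u x y → Φ T < Φ T′
  Φ-<-outside three with two-avoiding three (Unique.filter⁺ outside? (Unique.allFin⁺ n)) t
  ... | a , b , a∈ , b∈ , a≢b , a≢t , b≢t =
    Φ-< (fork connected (outside⇒core a∈) a≢t (outside⇒core b∈) b≢t a≢b)
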